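{- Let $q$ be a prime power and $n,k$ integers with $2\le k\le n-k$ and $n=[k]_q\cdot(q+1)$; let $V=\mathbb{F}_q^n$. Then there exist $X,Y\in\mathcal{C}(n,k)_q$ such that $d(X,Y)=k$ and $d_c(X,Y)=k+1$.
   Context: $\mathbb{F}_q$ is the finite field with $q$ elements. For $i=1,\dots,n$, $C_i=\{(x_1,\dots,x_n)\in V: x_i=0\}$. A non-degenerate linear $[n,k]_q$ code is a $k$-dimensional subspace of $V$ not contained in any $C_i$; $\mathcal{C}(n,k)_q$ is the set of all such codes. The Grassmann graph $\Gamma_k(V)$ has as vertices the $k$-dimensional subspaces of $V$, two adjacent iff their intersection is $(k-1)$-dimensional; its graph distance is $d(X,Y)=k-\dim(X\cap Y)$. $\Gamma(n,k)_q$ is the induced subgraph of $\Gamma_k(V)$ on $\mathcal{C}(n,k)_q$ (it is connected), and $d_c(X,Y)$ denotes the graph distance in $\Gamma(n,k)_q$. Notation: $[j]_q=\frac{q^j-1}{q-1}$. -}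

module Defs where

open import Level using (Level; _⊔_) renaming (suc to lsuc)
open import Algebra.Bundles using (CommutativeRing)
open import Data.Nat using (ℕ; zero; suc; _∸_; _^_; _≤_; pred)
import Data.Nat as N
open import Data.Nat.Primality using (Prime)
open import Data.Fin using (Fin)
import Data.Fin as Fin
open import Data.Product using (Σ; ∃; _×_; _,_)
open import Relation.Binary.PropositionalEquality using (_≡_)
open import Relation.Nullary using (¬_)

IsPrimePower : ℕ → Set
IsPrimePower q = Σ ℕ λ p → Σ ℕ λ e → Prime p × (1 ≤ e) × (q ≡ p ^ e)

-- Gaussian integer [j]_q = (q^j - 1)/(q - 1) = 1 + q + ... + q^(j-1)
[_]_ : ℕ → ℕ → ℕ
[ zero ] q = 0
[ suc j ] q = q ^ j N.+ [ j ] q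

record Field (c ℓ : Level) : Set (lsuc (c ⊔ ℓ)) where
  field
    commutativeRing : CommutativeRing c ℓ
  open CommutativeRing commutativeRing public
  field
    1≉0     : ¬ (1# ≈ 0#)
    inverse : ∀ x → ¬ (x ≈ 0#) → Σ Carrier λ y → (x * y) ≈ 1#

HasCardinality : ∀ {c ℓ} → Field c ℓ → ℕ → Set (c ⊔ ℓ)
HasCardinality F q = Σ (Fin q → Carrier) λ enum →
    (∀ i j → enum i ≈ enum j → i ≡ j) × (∀ x → Σ (Fin q) λ i → enum i ≈ x)
  where open Field F

module LinearAlgebra {c ℓ : Level} (F : Field c ℓ) (n : ℕ) where
  open Field F using (Carrier; _≈_; _+_; _*_; 0#)

  Vector : Set c
  Vector = Fin n → Carrier

  _≈ᵛ_ : Vector → Vector → Set ℓ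
  u ≈ᵛ v = ∀ i → u i ≈ v i

  zeroᵛ : Vector
  zeroᵛ _ = 0#

  _+ᵛ_ : Vector → Vector → Vector
  (u +ᵛ v) i = u i + v i

  _·ᵛ_ : Carrier → Vector → Vector
  (a ·ᵛ v) i = a * v i

  lincomb : ∀ {m} → (Fin m → Carrier) → (Fin m → Vector) → Vector
  lincomb {N.zero}  a v = zeroᵛ
  lincomb {N.suc m} a v = (a Fin.zero ·ᵛ v Fin.zero) +ᵛ lincomb (λ j → a (Fin.suc j)) (λ j → v (Fin.suc j))

  LinIndep : ∀ {m} → (Fin m → Vector) → Set (c ⊔ ℓ)
  LinIndep {m} v = ∀ a → lincomb a v ≈ᵛ zeroᵛ → ∀ j → a j ≈ 0#

  InSpan : ∀ {m} → (Fin m → Vector) → Vector → Set (c ⊔ ℓ)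
  InSpan {m} v x = Σ (Fin m → Carrier) λ a → lincomb a v ≈ᵛ x

  -- A k-dimensional subspace of V, given by a basis (the subspace is its span)
  record Subspace (k : ℕ) : Set (c ⊔ ℓ) where
    constructor subspace
    field
      basis  : Fin k → Vector
      indep  : LinIndep basis

  _∈_ : ∀ {k} → Vector → Subspace k → Set (c ⊔ ℓ)
  x ∈ X = InSpan (Subspace.basis X) x

  SameSubspace : ∀ {k} → Subspace k → Subspace k → Set (c ⊔ ℓ)
  SameSubspace X Y = ∀ x → (x ∈ X → x ∈ Y) × (x ∈ Y → x ∈ X)

  IntersectionHasDim : ∀ {k} → Subspace k → Subspace k → ℕ → Set (c ⊔ ℓ)
  IntersectionHasDim X Y m = Σ (Fin m → Vector) λ w →
      LinIndep w × (∀ j → (w j ∈ X) × (w j ∈ Y))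
      × (∀ x → x ∈ X → x ∈ Y → InSpan w x)

  GrassmannDist : ∀ {k} → Subspace k → Subspace k → ℕ → Set (c ⊔ ℓ)
  GrassmannDist {k} X Y d = Σ ℕ λ m → IntersectionHasDim X Y m × (d ≡ k ∸ m)

  Adjacent : ∀ {k} → Subspace k → Subspace k → Set (c ⊔ ℓ)
  Adjacent {k} X Y = IntersectionHasDim X Y (pred k)

  -- C_i = { x : x_i = 0 };  X non-degenerate: X not contained in any C_i
  NonDegenerate : ∀ {k} → Subspace k → Set (c ⊔ ℓ)
  NonDegenerate X = ∀ (i : Fin n) → ¬ (∀ x → x ∈ X → x i ≈ 0#)

  -- walks of length d in Γ(n,k)_q from X to Y (all intermediate vertices are codes)
  data Walk {k : ℕ} : Subspace k → Subspace k → ℕ → Set (c ⊔ ℓ) where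
    here : ∀ {X Y} → SameSubspace X Y → Walk X Y 0
    step : ∀ {X Y d} (Z : Subspace k) → NonDegenerate Z → Adjacent X Z
           → Walk Z Y d → Walk X Y (suc d)

  CodeDist : ∀ {k} → Subspace k → Subspace k → ℕ → Set (c ⊔ ℓ)
  CodeDist X Y d = Walk X Y d × (∀ m → Walk X Y m → d ≤ m)

-- X is the simplex code of length [k]_q repeated q + 1 times: its columns are indexed by a normalised
-- point π of PG(k - 1, q) and a slope s ∈ F_q ∪ {∞}. In column (π, s), Y has the point of slope s on the
-- line through e_a and e_β, where β is the last coordinate and a is the leading coordinate of π (or 0 if
-- that is β). The vectors x_j, y_j (j < k) and x_0 + d, with d the unit vector on the column (e_β, 0), are
-- independent: evaluating at the columns over the unit points gives dual linear forms. Hence X ∩ Y = 0.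
-- Replacing x_0 by x_0 + d, then x_j by y_j for j = β, β - 1, ..., 1, and finally x_0 + d by y_0 gives a walk
-- of length k + 1 through non-degenerate subspaces.
-- No walk through codes is shorter: dim (Z ∩ Y) grows by at most one per step, so a walk of length k would
-- begin with Z₁ = W ⊕ ⟨u⟩, W a hyperplane of X and u ∈ Y. W vanishes on all columns over the point π
-- orthogonal to W, and u vanishes on one of them, so Z₁ would be degenerate.

module Submission where

open import Defs
open import Level using (Level; _⊔_)
open import Algebra.Bundles using (CommutativeMonoid)
open import Data.Nat as ℕ using (ℕ; zero; suc; _≤_; _<_; _∸_; _^_; pred; z≤n; s≤s)
import Data.Nat.Properties as ℕ
open import Data.Fin as Fin
  using (Fin; zero; suc; toℕ; punchIn; inject≤; splitAt; finToFun; funToFin; _↑ˡ_; _↑ʳ_)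
import Data.Fin.Properties as Fin
open import Data.Vec.Functional using (_∷_; _++_; insertAt)
open import Data.Vec.Functional.Properties using (insertAt-punchIn; insertAt-lookup; lookup-++ˡ; lookup-++ʳ)
open import Data.Product using (Σ; ∃; _×_; _,_; proj₁; proj₂)
open import Data.Sum using (_⊎_; inj₁; inj₂; [_,_]′)
open import Data.Empty using (⊥; ⊥-elim)
open import Function using (_∘_; id)
open import Function.Definitions using (Injective)
open import Relation.Nullary using (¬_; Dec; yes; no; contradiction)
open import Relation.Nullary.Decidable using (_×-dec_; map′)
open import Relation.Binary using (Decidable)
open import Relation.Binary.PropositionalEquality as ≡ using (_≡_; _≢_)

module LinearAlgebraFacts {c ℓ : Level} (F : Field c ℓ) (_≟_ : Decidable (Field._≈_ F)) where
  open Field F hiding (zero)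
  open import Algebra.Properties.Ring ring
    using (-‿distribˡ-*; -‿distribʳ-*; [y-z]x≈yx-zx; -1*x≈-x; +-inverseˡ-unique; +-inverseʳ-unique;
           x≈y⇒x∙y⁻¹≈ε)
  open import Algebra.Properties.Semiring.Sum semiring
    using (sum; sum-syntax; sum-cong-≋; sum-cong-≗; sum-replicate-zero; sum-remove; ∑-distrib-+; ∑-comm;
           *-distribˡ-sum; *-distribʳ-sum)
  open import Relation.Binary.Reasoning.Setoid setoid

  x*y≈0⇒y≈0 : ∀ {x y} → ¬ x ≈ 0# → x * y ≈ 0# → y ≈ 0#
  x*y≈0⇒y≈0 {x} {y} x≉0 xy≈0 with inverse x x≉0
  ... | x⁻¹ , xx⁻¹≈1 = begin
    y              ≈⟨ *-identityˡ y ⟨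
    1# * y         ≈⟨ *-congʳ (trans (sym xx⁻¹≈1) (*-comm x x⁻¹)) ⟩
    x⁻¹ * x * y    ≈⟨ *-assoc x⁻¹ x y ⟩
    x⁻¹ * (x * y)  ≈⟨ *-congˡ xy≈0 ⟩
    x⁻¹ * 0#       ≈⟨ zeroʳ x⁻¹ ⟩
    0#             ∎

  nonzero-or-zero : ∀ {m} (v : Fin m → Carrier) → (∃ λ p → ¬ v p ≈ 0#) ⊎ (∀ p → v p ≈ 0#)
  nonzero-or-zero {m} v with Fin.all? (λ p → v p ≟ 0#)
  ... | yes v≈0 = inj₂ v≈0
  ... | no v≉0  = inj₁ (Fin.¬∀⟶∃¬ m _ (λ p → v p ≟ 0#) v≉0)

  ∑-≈0 : ∀ {m} {f : Fin m → Carrier} → (∀ i → f i ≈ 0#) → ∑[ i < m ] f i ≈ 0#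
  ∑-≈0 {m} f≈0 = trans (sum-cong-≋ f≈0) (sum-replicate-zero m)

  ∑-neg : ∀ {m} (f : Fin m → Carrier) → ∑[ i < m ] (- f i) ≈ - (∑[ i < m ] f i)
  ∑-neg {m} f = begin
    ∑[ i < m ] (- f i)       ≈⟨ sum-cong-≋ (λ i → sym (-1*x≈-x (f i))) ⟩
    ∑[ i < m ] (- 1# * f i)  ≈⟨ *-distribˡ-sum (- 1#) f ⟨
    - 1# * sum f             ≈⟨ -1*x≈-x (sum f) ⟩
    - sum f                  ∎

  ∑-++ : ∀ {m n} (f : Fin (m ℕ.+ n) → Carrier) →
         sum f ≈ ∑[ i < m ] f (i ↑ˡ n) + ∑[ i < n ] f (m ↑ʳ i)
  ∑-++ {zero}  f = sym (+-identityˡ _)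
  ∑-++ {suc m} {n} f = trans (+-congˡ (∑-++ {m} {n} (λ i → f (suc i)))) (sym (+-assoc _ _ _))

  δ : ∀ {m} → Fin m → Fin m → Carrier
  δ zero    zero    = 1#
  δ zero    (suc j) = 0#
  δ (suc i) zero    = 0#
  δ (suc i) (suc j) = δ i j

  δ-diag : ∀ {m} (i : Fin m) → δ i i ≡ 1#
  δ-diag zero    = ≡.refl
  δ-diag (suc i) = δ-diag i

  δ-off : ∀ {m} {i j : Fin m} → i ≢ j → δ i j ≡ 0#
  δ-off {i = zero}  {zero}  i≢j = contradiction ≡.refl i≢j
  δ-off {i = zero}  {suc j} _   = ≡.refl
  δ-off {i = suc i} {zero}  _   = ≡.refl
  δ-off {i = suc i} {suc j} i≢j = δ-off (λ i≡j → i≢j (≡.cong suc i≡j))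

  δ-sym : ∀ {m} (i j : Fin m) → δ i j ≡ δ j i
  δ-sym zero    zero    = ≡.refl
  δ-sym zero    (suc j) = ≡.refl
  δ-sym (suc i) zero    = ≡.refl
  δ-sym (suc i) (suc j) = δ-sym i j

  ∑-δˡ : ∀ {m} (f : Fin m → Carrier) (j : Fin m) → ∑[ i < m ] (f i * δ i j) ≈ f j
  ∑-δˡ {suc m} f zero = trans (+-cong (*-identityʳ _) (∑-≈0 {m} (λ i → zeroʳ _))) (+-identityʳ _)
  ∑-δˡ {suc m} f (suc j) = trans (+-cong (zeroʳ _) (∑-δˡ (λ i → f (suc i)) j)) (+-identityˡ _)

  ∑-δʳ : ∀ {m} (f : Fin m → Carrier) (j : Fin m) → ∑[ i < m ] (f i * δ j i) ≈ f j
  ∑-δʳ f j = trans (sum-cong-≋ (λ i → reflexive (≡.cong (f i *_) (δ-sym j i)))) (∑-δˡ f j)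

  δ-injective : ∀ {m m′} {f : Fin m → Fin m′} → Injective _≡_ _≡_ f → ∀ i j → δ (f i) (f j) ≡ δ i j
  δ-injective {f = f} f-inj i j with i Fin.≟ j
  ... | yes ≡.refl = ≡.trans (δ-diag (f i)) (≡.sym (δ-diag i))
  ... | no i≢j     = ≡.trans (δ-off (λ fi≡fj → i≢j (f-inj fi≡fj))) (≡.sym (δ-off i≢j))

  Solutions : ∀ {r s d} → (Fin r → Fin s → Carrier) → (Fin d → Fin s → Carrier) → Set ℓ
  Solutions {s = s} A K = ∀ t e → ∑[ j < s ] (A e j * K t j) ≈ 0#

  Independent : ∀ {d s} → (Fin d → Fin s → Carrier) → Set (c ⊔ ℓ)
  Independent {d} {s} K =
    ∀ (γ : Fin d → Carrier) → (∀ j → ∑[ t < d ] (γ t * K t j) ≈ 0#) → ∀ t → γ t ≈ 0#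

  IndependentSolutions : ∀ {r s} → (Fin r → Fin s → Carrier) → ℕ → Set (c ⊔ ℓ)
  IndependentSolutions {s = s} A d = Σ (Fin d → Fin s → Carrier) λ K → Solutions A K × Independent K

  Independent-nonzero : ∀ {s} (K : Fin 1 → Fin s → Carrier) → Independent K → ¬ (∀ j → K zero j ≈ 0#)
  Independent-nonzero K K-indep K≈0 = 1≉0 (K-indep (λ _ → 1#) γK≈0 zero)
    where
    γK≈0 : ∀ j → ∑[ t < 1 ] (1# * K t j) ≈ 0#
    γK≈0 j = trans (+-identityʳ _) (trans (*-identityˡ _) (K≈0 j))

  module Pivot {r s} (A : Fin (suc r) → Fin (suc s) → Carrier) (p : Fin (suc s))
               (Ap≉0 : ¬ A zero p ≈ 0#) where

    ι : Carrier
    ι = proj₁ (inverse (A zero p) Ap≉0)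

    reduced : Fin r → Fin s → Carrier
    reduced e j = A (suc e) (punchIn p j) - (A (suc e) p * ι) * A zero (punchIn p j)

    pivotValue : (Fin s → Carrier) → Carrier
    pivotValue κ = ∑[ j < s ] (A zero (punchIn p j) * κ j)

    extend : (Fin s → Carrier) → Fin (suc s) → Carrier
    extend κ = insertAt κ p (- (ι * pivotValue κ))

    ∑-extend : ∀ (b : Fin (suc s) → Carrier) κ →
               ∑[ j < suc s ] (b j * extend κ j) ≈
               ∑[ j < s ] (b (punchIn p j) * κ j) - (b p * ι) * pivotValue κ
    ∑-extend b κ = begin
      ∑[ j < suc s ] (b j * extend κ j)
        ≈⟨ sum-remove {i = p} (λ j → b j * extend κ j) ⟩
      b p * extend κ p + ∑[ j < s ] (b (punchIn p j) * extend κ (punchIn p j))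
        ≡⟨ ≡.cong₂ (λ u v → b p * u + v) (insertAt-lookup κ p _)
             (sum-cong-≗ (λ j → ≡.cong (b (punchIn p j) *_) (insertAt-punchIn κ p _ j))) ⟩
      b p * - (ι * pivotValue κ) + ∑[ j < s ] (b (punchIn p j) * κ j)
        ≈⟨ +-comm _ _ ⟩
      ∑[ j < s ] (b (punchIn p j) * κ j) + b p * - (ι * pivotValue κ)
        ≈⟨ +-congˡ (trans (sym (-‿distribʳ-* _ _)) (-‿cong (sym (*-assoc _ _ _)))) ⟩
      ∑[ j < s ] (b (punchIn p j) * κ j) - (b p * ι) * pivotValue κ
        ∎

    ∑-reduced : ∀ e κ → ∑[ j < s ] (reduced e j * κ j) ≈
                ∑[ j < s ] (A (suc e) (punchIn p j) * κ j) - (A (suc e) p * ι) * pivotValue κ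
    ∑-reduced e κ = begin
      ∑[ j < s ] (reduced e j * κ j)
        ≈⟨ sum-cong-≋ (λ j → [y-z]x≈yx-zx (κ j) _ _) ⟩
      ∑[ j < s ] (b j * κ j - μ * a j * κ j)
        ≈⟨ ∑-distrib-+ (λ j → b j * κ j) (λ j → - (μ * a j * κ j)) ⟩
      ∑[ j < s ] (b j * κ j) + ∑[ j < s ] (- (μ * a j * κ j))
        ≈⟨ +-congˡ (∑-neg (λ j → μ * a j * κ j)) ⟩
      ∑[ j < s ] (b j * κ j) - ∑[ j < s ] (μ * a j * κ j)
        ≈⟨ +-congˡ (-‿cong (trans (sum-cong-≋ (λ j → *-assoc μ (a j) (κ j)))
                                   (sym (*-distribˡ-sum μ (λ j → a j * κ j))))) ⟩
      ∑[ j < s ] (b j * κ j) - μ * pivotValue κ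
        ∎
      where
      b a : Fin s → Carrier
      b j = A (suc e) (punchIn p j)
      a j = A zero (punchIn p j)
      μ : Carrier
      μ = A (suc e) p * ι

    extend-solves-pivot-row : ∀ κ → ∑[ j < suc s ] (A zero j * extend κ j) ≈ 0#
    extend-solves-pivot-row κ = trans (∑-extend (A zero) κ) (x≈y⇒x∙y⁻¹≈ε (begin
      pivotValue κ                  ≈⟨ *-identityˡ _ ⟨
      1# * pivotValue κ             ≈⟨ *-congʳ (proj₂ (inverse (A zero p) Ap≉0)) ⟨
      A zero p * ι * pivotValue κ   ∎))

    extend-solves : ∀ κ e → ∑[ j < s ] (reduced e j * κ j) ≈ 0# →
                    ∑[ j < suc s ] (A (suc e) j * extend κ j) ≈ 0#
    extend-solves κ e reduced≈0 = trans (∑-extend (A (suc e)) κ) (trans (sym (∑-reduced e κ)) reduced≈0)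

    extend-independent : ∀ {d} {K : Fin d → Fin s → Carrier} →
                         Independent K → Independent (λ t → extend (K t))
    extend-independent {K = K} K-indep γ γK≈0 = K-indep γ (λ j →
      trans (reflexive (sum-cong-≗ (λ t → ≡.cong (γ t *_) (≡.sym (insertAt-punchIn (K t) p _ j)))))
            (γK≈0 (punchIn p j)))

  homogeneous-solutions : ∀ {r s} d → r ℕ.+ d ≤ s → (A : Fin r → Fin s → Carrier) →
                          IndependentSolutions A d
  homogeneous-solutions {zero} {s} d d≤s A = K , (λ t ()) , K-indep
    where
    K : Fin d → Fin s → Carrier
    K t = δ (inject≤ t d≤s)
    K-indep : Independent K
    K-indep γ γK≈0 t = begin
      γ t                                          ≈⟨ ∑-δˡ γ t ⟨
      ∑[ t′ < d ] (γ t′ * δ t′ t)                  ≡⟨ sum-cong-≗ (λ t′ → ≡.cong (γ t′ *_)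
                                                        (≡.sym (δ-injective (Fin.inject≤-injective _ _ _ _) t′ t))) ⟩
      ∑[ t′ < d ] (γ t′ * K t′ (inject≤ t d≤s))    ≈⟨ γK≈0 (inject≤ t d≤s) ⟩
      0#                                           ∎
  homogeneous-solutions {suc r} {zero} d () A
  homogeneous-solutions {suc r} {suc s} d r+d≤s A with nonzero-or-zero (A zero)
  ... | inj₂ A₀≈0 with homogeneous-solutions d (ℕ.≤-trans (ℕ.n≤1+n _) r+d≤s) (λ e → A (suc e))
  ...   | K , K-solves , K-indep = K , solves , K-indep
    where
    solves : Solutions A K
    solves t zero    = ∑-≈0 (λ j → trans (*-congʳ (A₀≈0 j)) (zeroˡ (K t j)))
    solves t (suc e) = K-solves t e
  homogeneous-solutions {suc r} {suc s} d r+d≤s A | inj₁ (p , Ap≉0)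
    with homogeneous-solutions d (ℕ.≤-pred r+d≤s) (Pivot.reduced A p Ap≉0)
  ...   | K , K-solves , K-indep = (λ t → extend (K t)) , solves , extend-independent K-indep
    where
    open Pivot A p Ap≉0
    solves : Solutions A (λ t → extend (K t))
    solves t zero    = extend-solves-pivot-row (K t)
    solves t (suc e) = extend-solves (K t) e (K-solves t e)

  ↑-elim : ∀ {m m' p} (P : Fin (m ℕ.+ m') → Set p) →
           (∀ i → P (i ↑ˡ m')) → (∀ i → P (m ↑ʳ i)) → ∀ x → P x
  ↑-elim {m} P left right x with Fin.splitAt m x in split≡
  ... | inj₁ i = ≡.subst P (Fin.splitAt⁻¹-↑ˡ split≡) (left i)
  ... | inj₂ i = ≡.subst P (Fin.splitAt⁻¹-↑ʳ split≡) (right i)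

  module Span (n : ℕ) where
    open LinearAlgebra F n

    lincomb-coord : ∀ {m} (a : Fin m → Carrier) (v : Fin m → Vector) i →
                    lincomb a v i ≡ ∑[ j < m ] (a j * v j i)
    lincomb-coord {zero}  a v i = ≡.refl
    lincomb-coord {suc m} a v i =
      ≡.cong (a zero * v zero i +_) (lincomb-coord (λ j → a (suc j)) (λ j → v (suc j)) i)

    lincomb-cong : ∀ {m} {a a' : Fin m → Carrier} (v : Fin m → Vector) → (∀ j → a j ≈ a' j) →
                   lincomb a v ≈ᵛ lincomb a' v
    lincomb-cong {m} {a} {a'} v a≈a' i = begin
      lincomb a v i              ≡⟨ lincomb-coord a v i ⟩
      ∑[ j < m ] (a j * v j i)   ≈⟨ sum-cong-≋ (λ j → *-congʳ (a≈a' j)) ⟩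
      ∑[ j < m ] (a' j * v j i)  ≡⟨ lincomb-coord a' v i ⟨
      lincomb a' v i             ∎

    lincomb-zero : ∀ {m} {a : Fin m → Carrier} (v : Fin m → Vector) → (∀ j → a j ≈ 0#) →
                   lincomb a v ≈ᵛ zeroᵛ
    lincomb-zero {a = a} v a≈0 i =
      trans (reflexive (lincomb-coord a v i)) (∑-≈0 (λ j → trans (*-congʳ (a≈0 j)) (zeroˡ _)))

    lincomb-of-zeros : ∀ {m} (a : Fin m → Carrier) {g : Fin m → Vector} → (∀ t → g t ≈ᵛ zeroᵛ) →
                       lincomb a g ≈ᵛ zeroᵛ
    lincomb-of-zeros a {g} g≈0 i =
      trans (reflexive (lincomb-coord a g i)) (∑-≈0 (λ t → trans (*-congˡ (g≈0 t i)) (zeroʳ (a t))))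

    lincomb-scale : ∀ {m} (μ : Carrier) (a : Fin m → Carrier) (v : Fin m → Vector) i →
                    lincomb (λ j → μ * a j) v i ≈ μ * lincomb a v i
    lincomb-scale {m} μ a v i = begin
      lincomb (λ j → μ * a j) v i     ≡⟨ lincomb-coord _ v i ⟩
      ∑[ j < m ] (μ * a j * v j i)    ≈⟨ sum-cong-≋ (λ j → *-assoc μ (a j) (v j i)) ⟩
      ∑[ j < m ] (μ * (a j * v j i))  ≈⟨ *-distribˡ-sum μ (λ j → a j * v j i) ⟨
      μ * ∑[ j < m ] (a j * v j i)    ≡⟨ ≡.cong (μ *_) (lincomb-coord a v i) ⟨
      μ * lincomb a v i             ∎

    lincomb-neg : ∀ {m} (a : Fin m → Carrier) (v : Fin m → Vector) i →
                  lincomb (λ t → - a t) v i ≈ - lincomb a v i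
    lincomb-neg a v i = begin
      lincomb (λ t → - a t) v i       ≈⟨ lincomb-cong v (λ t → sym (-1*x≈-x (a t))) i ⟩
      lincomb (λ t → - 1# * a t) v i  ≈⟨ lincomb-scale (- 1#) a v i ⟩
      - 1# * lincomb a v i            ≈⟨ -1*x≈-x _ ⟩
      - lincomb a v i                 ∎

    lincomb-δ : ∀ {m} (v : Fin m → Vector) (j : Fin m) → lincomb (δ j) v ≈ᵛ v j
    lincomb-δ {m} v j i = begin
      lincomb (δ j) v i             ≡⟨ lincomb-coord (δ j) v i ⟩
      ∑[ t < m ] (δ j t * v t i)    ≈⟨ sum-cong-≋ (λ t → *-comm (δ j t) (v t i)) ⟩
      ∑[ t < m ] (v t i * δ j t)    ≈⟨ ∑-δʳ (λ t → v t i) j ⟩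
      v j i                         ∎

    lincomb-remove : ∀ {m} (p : Fin (suc m)) (a : Fin (suc m) → Carrier) (v : Fin (suc m) → Vector) i →
                     lincomb a v i ≈ a p * v p i + lincomb (λ t → a (punchIn p t)) (λ t → v (punchIn p t)) i
    lincomb-remove {m} p a v i = begin
      lincomb a v i                                                ≡⟨ lincomb-coord a v i ⟩
      ∑[ t < suc m ] (a t * v t i)                                 ≈⟨ sum-remove {i = p} (λ t → a t * v t i) ⟩
      a p * v p i + ∑[ t < m ] (a (punchIn p t) * v (punchIn p t) i)
        ≡⟨ ≡.cong (a p * v p i +_) (lincomb-coord (λ t → a (punchIn p t)) (λ t → v (punchIn p t)) i) ⟨
      a p * v p i + lincomb (λ t → a (punchIn p t)) (λ t → v (punchIn p t)) i ∎

    lincomb-++ : ∀ {m m'} (a : Fin (m ℕ.+ m') → Carrier) (w : Fin m → Vector) (u : Fin m' → Vector) i →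
                 lincomb a (w ++ u) i ≈ lincomb (λ t → a (t ↑ˡ m')) w i + lincomb (λ t → a (m ↑ʳ t)) u i
    lincomb-++ {m} {m'} a w u i = begin
      lincomb a (w ++ u) i
        ≡⟨ lincomb-coord a _ i ⟩
      ∑[ t < m ℕ.+ m' ] (a t * (w ++ u) t i)
        ≈⟨ ∑-++ {m} {m'} (λ t → a t * (w ++ u) t i) ⟩
      ∑[ t < m ] (a (t ↑ˡ m') * (w ++ u) (t ↑ˡ m') i) + ∑[ t < m' ] (a (m ↑ʳ t) * (w ++ u) (m ↑ʳ t) i)
        ≡⟨ ≡.cong₂ _+_ (sum-cong-≗ (λ t → ≡.cong (λ x → a (t ↑ˡ m') * x i) (lookup-++ˡ w u t)))
                        (sum-cong-≗ (λ t → ≡.cong (λ x → a (m ↑ʳ t) * x i) (lookup-++ʳ w u t))) ⟩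
      ∑[ t < m ] (a (t ↑ˡ m') * w t i) + ∑[ t < m' ] (a (m ↑ʳ t) * u t i)
        ≡⟨ ≡.cong₂ _+_ (lincomb-coord _ w i) (lincomb-coord _ u i) ⟨
      lincomb (λ t → a (t ↑ˡ m')) w i + lincomb (λ t → a (m ↑ʳ t)) u i
        ∎

    lincomb-compose : ∀ {m r} (a : Fin m → Carrier) (g : Fin m → Vector) (b : Fin r → Vector)
                      (M : Fin m → Fin r → Carrier) → (∀ t → lincomb (M t) b ≈ᵛ g t) →
                      lincomb a g ≈ᵛ lincomb (λ e → ∑[ t < m ] (a t * M t e)) b
    lincomb-compose {m} {r} a g b M M·b≈g i = begin
      lincomb a g i
        ≡⟨ lincomb-coord a g i ⟩
      ∑[ t < m ] (a t * g t i)
        ≈⟨ sum-cong-≋ (λ t → *-congˡ (trans (sym (M·b≈g t i)) (reflexive (lincomb-coord (M t) b i)))) ⟩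
      ∑[ t < m ] (a t * ∑[ e < r ] (M t e * b e i))
        ≈⟨ sum-cong-≋ (λ t → *-distribˡ-sum (a t) (λ e → M t e * b e i)) ⟩
      ∑[ t < m ] ∑[ e < r ] (a t * (M t e * b e i))
        ≈⟨ ∑-comm (λ t e → a t * (M t e * b e i)) ⟩
      ∑[ e < r ] ∑[ t < m ] (a t * (M t e * b e i))
        ≈⟨ sum-cong-≋ (λ e → trans (sum-cong-≋ (λ t → sym (*-assoc (a t) (M t e) (b e i))))
                                   (sym (*-distribʳ-sum (b e i) (λ t → a t * M t e)))) ⟩
      ∑[ e < r ] (∑[ t < m ] (a t * M t e) * b e i)
        ≡⟨ lincomb-coord _ b i ⟨
      lincomb (λ e → ∑[ t < m ] (a t * M t e)) b i
        ∎

    InSpan-generator : ∀ {m} (v : Fin m → Vector) (j : Fin m) → InSpan v (v j)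
    InSpan-generator v j = δ j , lincomb-δ v j

    InSpan-resp-≈ᵛ : ∀ {m} {v : Fin m → Vector} {x y} → InSpan v x → x ≈ᵛ y → InSpan v y
    InSpan-resp-≈ᵛ (a , a·v≈x) x≈y = a , λ i → trans (a·v≈x i) (x≈y i)

    InSpan-lincomb : ∀ {m r} (a : Fin m → Carrier) {g : Fin m → Vector} {b : Fin r → Vector} →
                     (∀ t → InSpan b (g t)) → InSpan b (lincomb a g)
    InSpan-lincomb a {g} {b} g∈b =
      _ , λ i → sym (lincomb-compose a g b (λ t → proj₁ (g∈b t)) (λ t → proj₂ (g∈b t)) i)

    InSpan-scale : ∀ {m} {v : Fin m → Vector} (μ : Carrier) {x} → InSpan v x → InSpan v (μ ·ᵛ x)
    InSpan-scale {v = v} μ (a , a·v≈x) =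
      (λ t → μ * a t) , λ i → trans (lincomb-scale μ a v i) (*-congˡ (a·v≈x i))

    InSpan-vanishes : ∀ {m} {v : Fin m → Vector} {x} i → (∀ t → v t i ≈ 0#) → InSpan v x → x i ≈ 0#
    InSpan-vanishes {m} {v} {x} i v≈0 (a , a·v≈x) = begin
      x i                       ≈⟨ a·v≈x i ⟨
      lincomb a v i             ≡⟨ lincomb-coord a v i ⟩
      ∑[ t < m ] (a t * v t i)  ≈⟨ ∑-≈0 (λ t → trans (*-congˡ (v≈0 t)) (zeroʳ (a t))) ⟩
      0#                        ∎

    LinIndep-head-nonzero : ∀ {m} {u : Fin (suc m) → Vector} → LinIndep u → ¬ (u zero ≈ᵛ zeroᵛ)
    LinIndep-head-nonzero {m} {u} u-indep u₀≈0 = 1≉0 (begin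
      1#                       ≡⟨ δ-diag {suc m} zero ⟨
      δ {suc m} zero zero      ≈⟨ u-indep (δ zero) (λ i → trans (lincomb-δ u zero i) (u₀≈0 i)) zero ⟩
      0#                       ∎)

    scale-nonzero : ∀ {u} {μ} → ¬ (u ≈ᵛ zeroᵛ) → (μ ·ᵛ u) ≈ᵛ zeroᵛ → μ ≈ 0#
    scale-nonzero {u} {μ} u≉0 μu≈0 with nonzero-or-zero u
    ... | inj₁ (i , uᵢ≉0) = x*y≈0⇒y≈0 uᵢ≉0 (trans (*-comm (u i) μ) (μu≈0 i))
    ... | inj₂ u≈0        = contradiction u≈0 u≉0

    LinIndep-∷ : ∀ {m} {u} {w : Fin m → Vector} → LinIndep w →
                 (∀ γ₀ γ → ((γ₀ ·ᵛ u) +ᵛ lincomb γ w) ≈ᵛ zeroᵛ → γ₀ ≈ 0#) → LinIndep (u ∷ w)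
    LinIndep-∷ {w = w} w-indep head≈0 γ γ·u∷w≈0 zero = head≈0 _ _ γ·u∷w≈0
    LinIndep-∷ {w = w} w-indep head≈0 γ γ·u∷w≈0 (suc t) = w-indep _ tail·w≈0 t
      where
      tail·w≈0 : lincomb (λ t → γ (suc t)) w ≈ᵛ zeroᵛ
      tail·w≈0 i = trans (sym (+-identityˡ _))
        (trans (+-congʳ (sym (trans (*-congʳ (head≈0 _ _ γ·u∷w≈0)) (zeroˡ _)))) (γ·u∷w≈0 i))

    Relations : ∀ {s} → (Fin s → Vector) → ℕ → Set (c ⊔ ℓ)
    Relations {s} g d = Σ (Fin d → Fin s → Carrier) λ K → (∀ t → lincomb (K t) g ≈ᵛ zeroᵛ) × Independent K

    relations : ∀ {r s} d → r ℕ.+ d ≤ s → (g : Fin s → Vector) (b : Fin r → Vector) →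
                (∀ t → InSpan b (g t)) → Relations g d
    relations d r+d≤s g b g∈b with homogeneous-solutions d r+d≤s (λ e j → proj₁ (g∈b j) e)
    ... | K , solves , K-indep = K , K·g≈0 , K-indep
      where
      K·g≈0 : ∀ t → lincomb (K t) g ≈ᵛ zeroᵛ
      K·g≈0 t i = trans (lincomb-compose (K t) g b (λ j → proj₁ (g∈b j)) (λ j → proj₂ (g∈b j)) i)
                        (lincomb-zero b (λ e → trans (sum-cong-≋ (λ j → *-comm (K t j) (proj₁ (g∈b j) e)))
                                                     (solves t e)) i)

    lincomb-relations : ∀ {d s} (γ : Fin d → Carrier) (K : Fin d → Fin s → Carrier) (g : Fin s → Vector) →
                        (∀ t → lincomb (K t) g ≈ᵛ zeroᵛ) →
                        lincomb (λ j → ∑[ t < d ] (γ t * K t j)) g ≈ᵛ zeroᵛ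
    lincomb-relations γ K g K·g≈0 i =
      trans (sym (lincomb-compose γ (λ t → lincomb (K t) g) g K (λ t i → refl) i)) (lincomb-of-zeros γ K·g≈0 i)

    relations-++-independent : ∀ {m m′ d} {w : Fin m → Vector} {u : Fin m′ → Vector} → LinIndep w → LinIndep u →
                               ((K , _) : Relations (w ++ u) d) → LinIndep (λ t → lincomb (λ i → K t (m ↑ʳ i)) u)
    relations-++-independent {m} {m′} {d} {w} {u} w-indep u-indep (K , K·w++u≈0 , K-indep) γ γ·v≈0 =
      K-indep γ (↑-elim (λ x → γK x ≈ 0#) on-w on-u)
      where
      γK : Fin (m ℕ.+ m′) → Carrier
      γK x = ∑[ t < d ] (γ t * K t x)
      on-u : ∀ i → γK (m ↑ʳ i) ≈ 0#
      on-u = u-indep _ (λ i →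
        trans (sym (lincomb-compose γ _ u (λ t i → K t (m ↑ʳ i)) (λ t i → refl) i)) (γ·v≈0 i))
      on-w : ∀ i → γK (i ↑ˡ m′) ≈ 0#
      on-w = w-indep _ λ i → begin
        lincomb (λ t → γK (t ↑ˡ m′)) w i                                   ≈⟨ +-identityʳ _ ⟨
        lincomb (λ t → γK (t ↑ˡ m′)) w i + 0#                              ≈⟨ +-congˡ (lincomb-zero u on-u i) ⟨
        lincomb (λ t → γK (t ↑ˡ m′)) w i + lincomb (λ t → γK (m ↑ʳ t)) u i  ≈⟨ lincomb-++ γK w u i ⟨
        lincomb γK (w ++ u) i
          ≈⟨ lincomb-relations γ K (w ++ u) K·w++u≈0 i ⟩
        0#                                                                 ∎

    independent-spans : ∀ {m} (Z : Subspace m) {v : Fin m → Vector} → LinIndep v → (∀ t → v t ∈ Z) →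
                        ∀ {x} → x ∈ Z → InSpan v x
    independent-spans {m} Z {v} v-indep v∈Z {x} x∈Z
      with relations 1 (ℕ.≤-reflexive (ℕ.+-comm m 1)) (x ∷ v) (Subspace.basis Z)
                     (λ { zero → x∈Z ; (suc t) → v∈Z t })
    ... | K , K·x∷v≈0 , K-indep = (λ t → μ * κ (suc t)) , x≈μL
      where
      κ : Fin (suc m) → Carrier
      κ = K zero
      L : Vector
      L = lincomb (λ t → κ (suc t)) v
      κ₀x+L≈0 : ∀ i → κ zero * x i + L i ≈ 0#
      κ₀x+L≈0 = K·x∷v≈0 zero
      κ₀≉0 : ¬ κ zero ≈ 0#
      κ₀≉0 κ₀≈0 = Independent-nonzero K K-indep κ≈0
        where
        L≈0 : L ≈ᵛ zeroᵛ
        L≈0 i = trans (sym (+-identityˡ _))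
                      (trans (+-congʳ (sym (trans (*-congʳ κ₀≈0) (zeroˡ (x i))))) (κ₀x+L≈0 i))
        κ≈0 : ∀ t → κ t ≈ 0#
        κ≈0 zero    = κ₀≈0
        κ≈0 (suc t) = v-indep _ L≈0 t
      κ₀⁻¹ : Carrier
      κ₀⁻¹ = proj₁ (inverse (κ zero) κ₀≉0)
      μ : Carrier
      μ = - κ₀⁻¹
      x≈μL : ∀ i → lincomb (λ t → μ * κ (suc t)) v i ≈ x i
      x≈μL i = sym (begin
        x i                     ≈⟨ *-identityˡ (x i) ⟨
        1# * x i                ≈⟨ *-congʳ (trans (sym (proj₂ (inverse (κ zero) κ₀≉0))) (*-comm _ _)) ⟩
        κ₀⁻¹ * κ zero * x i     ≈⟨ *-assoc _ _ _ ⟩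
        κ₀⁻¹ * (κ zero * x i)   ≈⟨ *-congˡ (+-inverseˡ-unique _ _ (κ₀x+L≈0 i)) ⟩
        κ₀⁻¹ * - L i            ≈⟨ -‿distribʳ-* _ _ ⟨
        - (κ₀⁻¹ * L i)          ≈⟨ -‿distribˡ-* _ _ ⟩
        μ * L i                 ≈⟨ lincomb-scale μ _ v i ⟨
        lincomb (λ t → μ * κ (suc t)) v i ∎)

    Dim∩≥ : ∀ {k} → Subspace k → Subspace k → ℕ → Set (c ⊔ ℓ)
    Dim∩≥ Z Y j = Σ (Fin j → Vector) λ u → LinIndep u × (∀ t → (u t ∈ Z) × (u t ∈ Y))

    Dim∩≥-adjacent : ∀ {k} {Y Z W : Subspace (suc k)} {j} → Adjacent Z W → Dim∩≥ W Y j → Dim∩≥ Z Y (pred j)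
    Dim∩≥-adjacent {j = zero} _ _ = (λ ()) , (λ _ _ ()) , (λ ())
    Dim∩≥-adjacent {k} {Y} {Z} {W} {suc j} (w , w-indep , w∈Z∩W , _) (u , u-indep , u∈W∩Y) =
      v , relations-++-independent w-indep u-indep rel , λ t → v∈Z t , v∈Y t
      where
      w++u∈W : ∀ t → (w ++ u) t ∈ W
      w++u∈W = ↑-elim (λ t → (w ++ u) t ∈ W)
                 (λ t → ≡.subst (_∈ W) (≡.sym (lookup-++ˡ w u t)) (proj₂ (w∈Z∩W t)))
                 (λ t → ≡.subst (_∈ W) (≡.sym (lookup-++ʳ w u t)) (proj₁ (u∈W∩Y t)))
      rel : Relations (w ++ u) j
      rel = relations j (ℕ.≤-reflexive (≡.sym (ℕ.+-suc k j))) (w ++ u) (Subspace.basis W) w++u∈W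
      K : Fin j → Fin (k ℕ.+ suc j) → Carrier
      K = proj₁ rel
      v : Fin j → Vector
      v t = lincomb (λ i → K t (k ↑ʳ i)) u
      v∈Y : ∀ t → v t ∈ Y
      v∈Y t = InSpan-lincomb (λ i → K t (k ↑ʳ i)) {b = Subspace.basis Y} (λ i → proj₂ (u∈W∩Y i))
      v∈Z : ∀ t → v t ∈ Z
      v∈Z t = InSpan-resp-≈ᵛ {v = Subspace.basis Z}
                (InSpan-lincomb (λ i → - K t (i ↑ˡ suc j)) {b = Subspace.basis Z} (λ i → proj₁ (w∈Z∩W i)))
                −α·w≈v
        where
        −α·w≈v : lincomb (λ i → - K t (i ↑ˡ suc j)) w ≈ᵛ v t
        −α·w≈v i = trans (lincomb-neg _ w i)
          (sym (+-inverseʳ-unique _ _ (trans (sym (lincomb-++ (K t) w u i)) (proj₁ (proj₂ rel) t i))))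

    Dim∩≥-walk : ∀ {k} {Z Y : Subspace (suc k)} {m} → Walk Z Y m → Dim∩≥ Z Y (suc k ∸ m)
    Dim∩≥-walk {Y = Y} (here Z≡Y) =
      Subspace.basis Y , Subspace.indep Y ,
      λ t → proj₂ (Z≡Y _) (InSpan-generator (Subspace.basis Y) t) , InSpan-generator (Subspace.basis Y) t
    Dim∩≥-walk {k} {Z} {Y} {suc m} (step W _ Z~W W⇝Y) =
      ≡.subst (Dim∩≥ Z Y) (ℕ.pred[m∸n]≡m∸[1+n] (suc k) m)
              (Dim∩≥-adjacent {Y = Y} {Z} {W} Z~W (Dim∩≥-walk W⇝Y))

enumerable⇒decidable : ∀ {c ℓ} (F : Field c ℓ) {q} → HasCardinality F q → Decidable (Field._≈_ F)
enumerable⇒decidable F {q} (enum , enum-injective , enum-surjective) x y =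
  map′ (λ σ≡τ → trans (sym σ≈x) (trans (reflexive (≡.cong enum σ≡τ)) τ≈y))
       (λ x≈y → enum-injective σ τ (trans σ≈x (trans x≈y (sym τ≈y))))
       (σ Fin.≟ τ)
  where
  open Field F
  σ τ : Fin q
  σ = proj₁ (enum-surjective x)
  τ = proj₁ (enum-surjective y)
  σ≈x : enum σ ≈ x
  σ≈x = proj₂ (enum-surjective x)
  τ≈y : enum τ ≈ y
  τ≈y = proj₂ (enum-surjective y)

module NormalisedPoints {c ℓ : Level} (F : Field c ℓ) (q : ℕ) (card : HasCardinality F q) where
  open Field F hiding (zero)

  _≟_ : Decidable _≈_
  _≟_ = enumerable⇒decidable F card

  open LinearAlgebraFacts F _≟_
  open import Relation.Binary.Reasoning.Setoid setoid

  enum : Fin q → Carrier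
  enum = proj₁ card

  name : (x : Carrier) → Σ (Fin q) λ σ → enum σ ≈ x
  name = proj₂ (proj₂ card)

  data Point : ℕ → Set where
    here  : ∀ {j} → Fin (q ^ j) → Point (suc j)
    there : ∀ {j} → Point j → Point (suc j)

  point : ∀ {j} → Fin ([ j ] q) → Point j
  point {suc j} i = [ here , there ∘ point ]′ (splitAt (q ^ j) i)

  index : ∀ {j} → Point j → Fin ([ j ] q)
  index {suc j} (here a)  = a ↑ˡ [ j ] q
  index {suc j} (there π) = q ^ j ↑ʳ index π

  point-index : ∀ {j} (π : Point j) → point (index π) ≡ π
  point-index {suc j} (here a)  rewrite Fin.splitAt-↑ˡ (q ^ j) a ([ j ] q) = ≡.refl
  point-index {suc j} (there π) rewrite Fin.splitAt-↑ʳ (q ^ j) ([ j ] q) (index π) =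
    ≡.cong there (point-index π)

  coord : ∀ {j} → Point j → Fin j → Carrier
  coord (here a)  zero    = 1#
  coord (here a)  (suc m) = enum (finToFun a m)
  coord (there π) zero    = 0#
  coord (there π) (suc m) = coord π m

  lead : ∀ {j} → Point j → Fin j
  lead (here a)  = zero
  lead (there π) = suc (lead π)

  coord-lead : ∀ {j} (π : Point j) → coord π (lead π) ≡ 1#
  coord-lead (here a)  = ≡.refl
  coord-lead (there π) = coord-lead π

  coord-zero : ∀ {j} (π : Point (suc j)) → lead π ≢ zero → coord π zero ≡ 0#
  coord-zero (here a)  lead≢0 = contradiction ≡.refl lead≢0
  coord-zero (there π) _      = ≡.refl

  σ₀ : Fin q
  σ₀ = proj₁ (name 0#)

  unit : ∀ {j} → Fin j → Point j
  unit {suc j} zero = here (funToFin {j} (λ _ → σ₀))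
  unit (suc i) = there (unit i)

  lead-unit : ∀ {j} (i : Fin j) → lead (unit i) ≡ i
  lead-unit zero    = ≡.refl
  lead-unit (suc i) = ≡.cong suc (lead-unit i)

  coord-unit : ∀ {j} (i m : Fin j) → coord (unit i) m ≈ δ i m
  coord-unit zero    zero    = refl
  coord-unit zero    (suc m) =
    trans (reflexive (≡.cong enum (Fin.finToFun-funToFin (λ _ → σ₀) m))) (proj₂ (name 0#))
  coord-unit (suc i) zero    = refl
  coord-unit (suc i) (suc m) = coord-unit i m

  normalise : ∀ {j} (p : Fin j → Carrier) → ¬ (∀ m → p m ≈ 0#) →
              Σ (Point j) λ π → Σ Carrier λ μ → ¬ μ ≈ 0# × (∀ m → coord π m ≈ μ * p m)
  normalise {zero}  p p≉0 = contradiction (λ ()) p≉0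
  normalise {suc j} p p≉0 with p zero ≟ 0#
  ... | no p₀≉0 = here (funToFin a) , μ , μ≉0 , coord≈μp
    where
    μ : Carrier
    μ = proj₁ (inverse (p zero) p₀≉0)
    p₀μ≈1 : p zero * μ ≈ 1#
    p₀μ≈1 = proj₂ (inverse (p zero) p₀≉0)
    μ≉0 : ¬ μ ≈ 0#
    μ≉0 μ≈0 = 1≉0 (trans (sym p₀μ≈1) (trans (*-congˡ μ≈0) (zeroʳ _)))
    a : Fin j → Fin q
    a m = proj₁ (name (μ * p (suc m)))
    coord≈μp : ∀ m → coord (here (funToFin a)) m ≈ μ * p m
    coord≈μp zero    = trans (sym p₀μ≈1) (*-comm _ _)
    coord≈μp (suc m) = trans (reflexive (≡.cong enum (Fin.finToFun-funToFin a m))) (proj₂ (name _))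
  ... | yes p₀≈0 with normalise (λ m → p (suc m)) (λ p′≈0 → p≉0 λ { zero → p₀≈0 ; (suc m) → p′≈0 m })
  ...   | π , μ , μ≉0 , coord≈μp = there π , μ , μ≉0 , λ
          { zero    → sym (trans (*-congˡ p₀≈0) (zeroʳ μ))
          ; (suc m) → coord≈μp m }

module Construction {c ℓ : Level} (F : Field c ℓ) (q : ℕ) (card : HasCardinality F q) (k₀ : ℕ) where
  open Field F hiding (zero)
  open import Algebra.Properties.Ring ring
    using (-‿distribˡ-*; +-inverseˡ-unique; x≈y⇒x∙y⁻¹≈ε; xyx⁻¹≈y; -0#≈0#; x[y-z]≈xy-xz; -‿+-comm)
  open import Algebra.Properties.CommutativeSemigroup (CommutativeMonoid.commutativeSemigroup +-commutativeMonoid)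
    using (interchange)
  open import Algebra.Properties.CommutativeSemigroup (CommutativeMonoid.commutativeSemigroup *-commutativeMonoid)
    using (x∙yz≈y∙xz)
  open NormalisedPoints F q card
  open LinearAlgebraFacts F _≟_
  open import Algebra.Properties.Semiring.Sum semiring
    using (sum-syntax; sum-cong-≋; sum-cong-≗; ∑-distrib-+; *-distribˡ-sum)
  open import Relation.Binary.Reasoning.Setoid setoid

  k′ k n : ℕ
  k′ = suc k₀
  k  = suc k′
  n  = [ k ] q ℕ.* (q ℕ.+ 1)

  open LinearAlgebra F n
  open Span n

  Slope : Set
  Slope = Fin q ⊎ Fin 1

  pointAt : Fin n → Point k
  pointAt i = point (proj₁ (Fin.remQuot {[ k ] q} (q ℕ.+ 1) i))

  slopeAt : Fin n → Slope
  slopeAt i = splitAt q (proj₂ (Fin.remQuot {[ k ] q} (q ℕ.+ 1) i))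

  column : Point k → Slope → Fin n
  column π s = Fin.combine (index π) (Fin.join q 1 s)

  columnVector : (Point k → Slope → Carrier) → Vector
  columnVector f i = f (pointAt i) (slopeAt i)

  columnVector-column : ∀ f π s → columnVector f (column π s) ≡ f π s
  columnVector-column f π s = ≡.cong₂ f
    (≡.trans (≡.cong (point ∘ proj₁) remQuot≡) (point-index π))
    (≡.trans (≡.cong (splitAt q ∘ proj₂) remQuot≡) (Fin.splitAt-join q 1 s))
    where
    remQuot≡ : Fin.remQuot (q ℕ.+ 1) (column π s) ≡ (index π , Fin.join q 1 s)
    remQuot≡ = Fin.remQuot-combine (index π) (Fin.join q 1 s)

  β : Fin k
  β = Fin.fromℕ k′

  0≢β : zero ≢ β
  0≢β ()

  base : Fin k → Fin k
  base f with f Fin.≟ β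
  ... | yes _ = zero
  ... | no  _ = f

  base-≢β : ∀ {f} → f ≢ β → base f ≡ f
  base-≢β {f} f≢β with f Fin.≟ β
  ... | yes f≡β = contradiction f≡β f≢β
  ... | no  _   = ≡.refl

  base≢β : ∀ f → base f ≢ β
  base≢β f with f Fin.≟ β
  ... | yes _   = 0≢β
  ... | no  f≢β = f≢β

  line : Fin k → Slope → Fin k → Carrier
  line a (inj₁ σ) j = δ a j + enum σ * δ β j
  line a (inj₂ _) j = δ β j

  𝟙 : ∀ {p} {P : Set p} → Dec P → Carrier
  𝟙 (yes _) = 1#
  𝟙 (no  _) = 0#

  marker : Fin k → Slope → Carrier
  marker f (inj₁ σ) = 𝟙 ((f Fin.≟ β) ×-dec (enum σ ≟ 0#))
  marker f (inj₂ _) = 0#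

  data Generator : Set where
    gx gy : Fin k → Generator
    gz    : Generator

  -- The entries of x_j, y_j and x_0 + d in column (π, s); marker is d, since e_β is the only point
  -- with lead β.
  value : Generator → Point k → Slope → Carrier
  value (gx j) π s = coord π j
  value (gy j) π s = line (base (lead π)) s j
  value gz     π s = coord π zero + marker (lead π) s

  vec : Generator → Vector
  vec g = columnVector (value g)

  dv : Vector
  dv = columnVector (λ π s → marker (lead π) s)

  -- Linear forms dual to the generators

  data Form : Set where
    ev        : Fin n → Form
    _⊕_ _⊖_  : Form → Form → Form

  ⟦_⟧ : Form → Vector → Carrier
  ⟦ ev i  ⟧ v = v i
  ⟦ f ⊕ g ⟧ v = ⟦ f ⟧ v + ⟦ g ⟧ v
  ⟦ f ⊖ g ⟧ v = ⟦ f ⟧ v - ⟦ g ⟧ v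

  ⟦⟧-cong : ∀ f {u v} → u ≈ᵛ v → ⟦ f ⟧ u ≈ ⟦ f ⟧ v
  ⟦⟧-cong (ev i)  u≈v = u≈v i
  ⟦⟧-cong (f ⊕ g) u≈v = +-cong (⟦⟧-cong f u≈v) (⟦⟧-cong g u≈v)
  ⟦⟧-cong (f ⊖ g) u≈v = +-cong (⟦⟧-cong f u≈v) (-‿cong (⟦⟧-cong g u≈v))

  ⟦⟧-lincomb : ∀ {m} f (γ : Fin m → Carrier) (v : Fin m → Vector) →
               ⟦ f ⟧ (lincomb γ v) ≈ ∑[ t < m ] (γ t * ⟦ f ⟧ (v t))
  ⟦⟧-lincomb (ev i) γ v = reflexive (lincomb-coord γ v i)
  ⟦⟧-lincomb {m} (f ⊕ g) γ v = begin
    ⟦ f ⟧ (lincomb γ v) + ⟦ g ⟧ (lincomb γ v)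
      ≈⟨ +-cong (⟦⟧-lincomb f γ v) (⟦⟧-lincomb g γ v) ⟩
    ∑[ t < m ] (γ t * ⟦ f ⟧ (v t)) + ∑[ t < m ] (γ t * ⟦ g ⟧ (v t))
      ≈⟨ ∑-distrib-+ (λ t → γ t * ⟦ f ⟧ (v t)) (λ t → γ t * ⟦ g ⟧ (v t)) ⟨
    ∑[ t < m ] (γ t * ⟦ f ⟧ (v t) + γ t * ⟦ g ⟧ (v t))
      ≈⟨ sum-cong-≋ (λ t → sym (distribˡ (γ t) _ _)) ⟩
    ∑[ t < m ] (γ t * ⟦ f ⊕ g ⟧ (v t))
      ∎
  ⟦⟧-lincomb {m} (f ⊖ g) γ v = begin
    ⟦ f ⟧ (lincomb γ v) - ⟦ g ⟧ (lincomb γ v)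
      ≈⟨ +-cong (⟦⟧-lincomb f γ v) (-‿cong (⟦⟧-lincomb g γ v)) ⟩
    ∑[ t < m ] (γ t * ⟦ f ⟧ (v t)) - ∑[ t < m ] (γ t * ⟦ g ⟧ (v t))
      ≈⟨ +-congˡ (∑-neg (λ t → γ t * ⟦ g ⟧ (v t))) ⟨
    ∑[ t < m ] (γ t * ⟦ f ⟧ (v t)) + ∑[ t < m ] (- (γ t * ⟦ g ⟧ (v t)))
      ≈⟨ ∑-distrib-+ (λ t → γ t * ⟦ f ⟧ (v t)) (λ t → - (γ t * ⟦ g ⟧ (v t))) ⟨
    ∑[ t < m ] (γ t * ⟦ f ⟧ (v t) - γ t * ⟦ g ⟧ (v t))
      ≈⟨ sum-cong-≋ (λ t → sym (x[y-z]≈xy-xz (γ t) _ _)) ⟩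
    ∑[ t < m ] (γ t * ⟦ f ⊖ g ⟧ (v t))
      ∎

  x+y-y≈x : ∀ x y → x + y - y ≈ x
  x+y-y≈x x y = trans (+-assoc x y (- y)) (trans (+-congˡ (-‿inverseʳ y)) (+-identityʳ x))

  x-0≈x : ∀ x → x - 0# ≈ x
  x-0≈x x = trans (+-congˡ -0#≈0#) (+-identityʳ x)

  σ₁ : Fin q
  σ₁ = proj₁ (name 1#)

  s₀ s₁ ∞ : Slope
  s₀ = inj₁ σ₀
  s₁ = inj₁ σ₁
  ∞  = inj₂ zero

  line-s₀ : ∀ a j → line a s₀ j ≈ δ a j
  line-s₀ a j = trans (+-congˡ (trans (*-congʳ (proj₂ (name 0#))) (zeroˡ _))) (+-identityʳ _)

  line-s₁ : ∀ a j → line a s₁ j ≈ δ a j + δ β j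
  line-s₁ a j = +-congˡ (trans (*-congʳ (proj₂ (name 1#))) (*-identityˡ _))

  marker-zero-slope : ∀ {f σ} → f ≡ β → enum σ ≈ 0# → marker f (inj₁ σ) ≡ 1#
  marker-zero-slope {f} {σ} f≡β σ≈0 with f Fin.≟ β | enum σ ≟ 0#
  ... | yes _   | yes _    = ≡.refl
  ... | no  f≢β | _        = contradiction f≡β f≢β
  ... | yes _   | no  σ≉0  = contradiction σ≈0 σ≉0

  marker-≢β : ∀ {f} s → f ≢ β → marker f s ≡ 0#
  marker-≢β {f} (inj₁ σ) f≢β with f Fin.≟ β
  ... | yes f≡β = contradiction f≡β f≢β
  ... | no  _   = ≡.refl
  marker-≢β (inj₂ _) _ = ≡.refl

  marker-s₁ : ∀ f → marker f s₁ ≡ 0#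
  marker-s₁ f with f Fin.≟ β | enum σ₁ ≟ 0#
  ... | yes _ | yes σ₁≈0 = contradiction (trans (sym (proj₂ (name 1#))) σ₁≈0) 1≉0
  ... | yes _ | no  _    = ≡.refl
  ... | no  _ | _        = ≡.refl

  at : Fin k → Slope → Form
  at j s = ev (column (unit j) s)

  at-x : ∀ j s j′ → ⟦ at j s ⟧ (vec (gx j′)) ≈ δ j j′
  at-x j s j′ = trans (reflexive (columnVector-column (value (gx j′)) (unit j) s)) (coord-unit j j′)

  at-y : ∀ j s j′ → ⟦ at j s ⟧ (vec (gy j′)) ≡ line (base j) s j′
  at-y j s j′ =
    ≡.trans (columnVector-column (value (gy j′)) (unit j) s) (≡.cong (λ f → line (base f) s j′) (lead-unit j))

  at-d : ∀ j s → ⟦ at j s ⟧ dv ≡ marker j s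
  at-d j s =
    ≡.trans (columnVector-column (λ π s → marker (lead π) s) (unit j) s) (≡.cong (λ f → marker f s) (lead-unit j))

  ⟦⟧-+ᵛ : ∀ f u v → ⟦ f ⟧ (u +ᵛ v) ≈ ⟦ f ⟧ u + ⟦ f ⟧ v
  ⟦⟧-+ᵛ (ev i)  u v = refl
  ⟦⟧-+ᵛ (f ⊕ g) u v = trans (+-cong (⟦⟧-+ᵛ f u v) (⟦⟧-+ᵛ g u v)) (interchange _ _ _ _)
  ⟦⟧-+ᵛ (f ⊖ g) u v =
    trans (+-cong (⟦⟧-+ᵛ f u v) (trans (-‿cong (⟦⟧-+ᵛ g u v)) (sym (-‿+-comm _ _)))) (interchange _ _ _ _)

  ⟦⟧-zeroᵛ : ∀ f → ⟦ f ⟧ zeroᵛ ≈ 0#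
  ⟦⟧-zeroᵛ f = ⟦⟧-lincomb {0} f (λ ()) (λ ())

  η : Fin k → Form
  η j = at j s₁ ⊖ at j ∞

  η-x : ∀ j j′ → ⟦ η j ⟧ (vec (gx j′)) ≈ 0#
  η-x j j′ = x≈y⇒x∙y⁻¹≈ε (trans (at-x j s₁ j′) (sym (at-x j ∞ j′)))

  η-y : ∀ j j′ → ⟦ η j ⟧ (vec (gy j′)) ≈ δ (base j) j′
  η-y j j′ =
    trans (+-cong (trans (reflexive (at-y j s₁ j′)) (line-s₁ (base j) j′)) (-‿cong (reflexive (at-y j ∞ j′))))
                   (x+y-y≈x _ _)

  η-d : ∀ j → ⟦ η j ⟧ dv ≈ 0#
  η-d j = x≈y⇒x∙y⁻¹≈ε (reflexive (≡.trans (at-d j s₁) (≡.trans (marker-s₁ j) (≡.sym (at-d j ∞)))))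

  ηβ : Form
  ηβ = at zero s₁ ⊖ at zero s₀

  ηβ-x : ∀ j′ → ⟦ ηβ ⟧ (vec (gx j′)) ≈ 0#
  ηβ-x j′ = x≈y⇒x∙y⁻¹≈ε (trans (at-x zero s₁ j′) (sym (at-x zero s₀ j′)))

  ηβ-y : ∀ j′ → ⟦ ηβ ⟧ (vec (gy j′)) ≈ δ β j′
  ηβ-y j′ = trans (+-cong (trans (reflexive (at-y zero s₁ j′)) (line-s₁ (base zero) j′))
                          (-‿cong (trans (reflexive (at-y zero s₀ j′)) (line-s₀ (base zero) j′))))
                  (xyx⁻¹≈y _ _)

  ηβ-d : ⟦ ηβ ⟧ dv ≈ 0#
  ηβ-d = x≈y⇒x∙y⁻¹≈ε (reflexive (≡.trans (at-d zero s₁) (≡.trans (marker-s₁ zero)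
           (≡.sym (≡.trans (at-d zero s₀) (marker-≢β s₀ 0≢β))))))

  ξ : Fin k → Form
  ξ j = (at j s₀ ⊕ at j ∞) ⊖ at j s₁

  ξ-x : ∀ j j′ → ⟦ ξ j ⟧ (vec (gx j′)) ≈ δ j j′
  ξ-x j j′ = trans (+-cong (+-congˡ (at-x j ∞ j′)) (-‿cong (at-x j s₁ j′)))
               (trans (+-congʳ (+-congʳ (at-x j s₀ j′))) (x+y-y≈x _ _))

  ξ-y : ∀ j j′ → ⟦ ξ j ⟧ (vec (gy j′)) ≈ 0#
  ξ-y j j′ = x≈y⇒x∙y⁻¹≈ε (begin
    ⟦ at j s₀ ⟧ (vec (gy j′)) + ⟦ at j ∞ ⟧ (vec (gy j′))  ≡⟨ ≡.cong₂ _+_ (at-y j s₀ j′) (at-y j ∞ j′) ⟩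
    line (base j) s₀ j′ + δ β j′                          ≈⟨ +-congʳ (line-s₀ (base j) j′) ⟩
    δ (base j) j′ + δ β j′                                ≈⟨ line-s₁ (base j) j′ ⟨
    line (base j) s₁ j′                                   ≡⟨ at-y j s₁ j′ ⟨
    ⟦ at j s₁ ⟧ (vec (gy j′))                             ∎)

  ξ-d : ∀ j → ⟦ ξ j ⟧ dv ≈ marker j s₀
  ξ-d j = trans (+-cong (+-cong (reflexive (at-d j s₀)) (reflexive (at-d j ∞)))
                        (-‿cong (reflexive (≡.trans (at-d j s₁) (marker-s₁ j)))))
                (trans (x-0≈x _) (+-identityʳ _))

  Φy : Fin k → Form
  Φy j with j Fin.≟ β
  ... | yes _ = ηβ
  ... | no  _ = η j

  Φy-x : ∀ j j′ → ⟦ Φy j ⟧ (vec (gx j′)) ≈ 0#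
  Φy-x j j′ with j Fin.≟ β
  ... | yes _ = ηβ-x j′
  ... | no  _ = η-x j j′

  Φy-y : ∀ j j′ → ⟦ Φy j ⟧ (vec (gy j′)) ≈ δ j j′
  Φy-y j j′ with j Fin.≟ β
  ... | yes ≡.refl = ηβ-y j′
  ... | no  j≢β    = trans (η-y j j′) (reflexive (≡.cong (λ a → δ a j′) (base-≢β j≢β)))

  Φy-d : ∀ j → ⟦ Φy j ⟧ dv ≈ 0#
  Φy-d j with j Fin.≟ β
  ... | yes _ = ηβ-d
  ... | no  _ = η-d j

  Φx : Fin k → Form
  Φx j with j Fin.≟ β
  ... | yes _ = at β ∞ ⊖ ηβ
  ... | no  _ = ξ j

  Φx-x : ∀ j j′ → ⟦ Φx j ⟧ (vec (gx j′)) ≈ δ j j′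
  Φx-x j j′ with j Fin.≟ β
  ... | yes ≡.refl = trans (+-cong (at-x β ∞ j′) (-‿cong (ηβ-x j′))) (x-0≈x _)
  ... | no  _      = ξ-x j j′

  Φx-y : ∀ j j′ → ⟦ Φx j ⟧ (vec (gy j′)) ≈ 0#
  Φx-y j j′ with j Fin.≟ β
  ... | yes ≡.refl = x≈y⇒x∙y⁻¹≈ε (trans (reflexive (at-y β ∞ j′)) (sym (ηβ-y j′)))
  ... | no  _      = ξ-y j j′

  Φx-d : ∀ j → ⟦ Φx j ⟧ dv ≈ 0#
  Φx-d j with j Fin.≟ β
  ... | yes ≡.refl = x≈y⇒x∙y⁻¹≈ε (trans (reflexive (at-d β ∞)) (sym ηβ-d))
  ... | no  j≢β    = trans (ξ-d j) (reflexive (marker-≢β s₀ j≢β))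

  Φd : Form
  Φd = ξ β ⊖ Φx β

  Φd-x : ∀ j′ → ⟦ Φd ⟧ (vec (gx j′)) ≈ 0#
  Φd-x j′ = x≈y⇒x∙y⁻¹≈ε (trans (ξ-x β j′) (sym (Φx-x β j′)))

  Φd-y : ∀ j′ → ⟦ Φd ⟧ (vec (gy j′)) ≈ 0#
  Φd-y j′ = x≈y⇒x∙y⁻¹≈ε (trans (ξ-y β j′) (sym (Φx-y β j′)))

  Φd-d : ⟦ Φd ⟧ dv ≈ 1#
  Φd-d = trans (+-cong (ξ-d β) (-‿cong (Φx-d β)))
              (trans (x-0≈x _) (reflexive (marker-zero-slope ≡.refl (proj₂ (name 0#)))))

  on-gz : ∀ f → ⟦ f ⟧ (vec gz) ≈ ⟦ f ⟧ (vec (gx zero)) + ⟦ f ⟧ dv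
  on-gz f = ⟦⟧-+ᵛ f (vec (gx zero)) dv

  φ : Generator → Form
  φ (gx zero)    = Φx zero ⊖ Φd
  φ (gx (suc j)) = Φx (suc j)
  φ (gy j)       = Φy j
  φ gz           = Φd

  δᴳ : Generator → Generator → Carrier
  δᴳ (gx j) (gx j′) = δ j j′
  δᴳ (gx j) (gy j′) = 0#
  δᴳ (gx j) gz      = 0#
  δᴳ (gy j) (gx j′) = 0#
  δᴳ (gy j) (gy j′) = δ j j′
  δᴳ (gy j) gz      = 0#
  δᴳ gz     (gx j′) = 0#
  δᴳ gz     (gy j′) = 0#
  δᴳ gz     gz      = 1#

  φ-dual : ∀ g g′ → ⟦ φ g ⟧ (vec g′) ≈ δᴳ g g′
  φ-dual (gx zero) (gx j′) = trans (+-cong (Φx-x zero j′) (-‿cong (Φd-x j′))) (x-0≈x _)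
  φ-dual (gx zero) (gy j′) = x≈y⇒x∙y⁻¹≈ε (trans (Φx-y zero j′) (sym (Φd-y j′)))
  φ-dual (gx zero) gz      = x≈y⇒x∙y⁻¹≈ε (begin
    ⟦ Φx zero ⟧ (vec gz)  ≈⟨ trans (on-gz (Φx zero)) (+-cong (Φx-x zero zero) (Φx-d zero)) ⟩
    1# + 0#              ≈⟨ +-comm _ _ ⟩
    0# + 1#              ≈⟨ trans (on-gz Φd) (+-cong (Φd-x zero) Φd-d) ⟨
    ⟦ Φd ⟧ (vec gz)       ∎)
  φ-dual (gx (suc j)) (gx j′) = Φx-x (suc j) j′
  φ-dual (gx (suc j)) (gy j′) = Φx-y (suc j) j′
  φ-dual (gx (suc j)) gz      =
    trans (on-gz (Φx (suc j))) (trans (+-cong (Φx-x (suc j) zero) (Φx-d (suc j))) (+-identityʳ _))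
  φ-dual (gy j) (gx j′) = Φy-x j j′
  φ-dual (gy j) (gy j′) = Φy-y j j′
  φ-dual (gy j) gz      = trans (on-gz (Φy j)) (trans (+-cong (Φy-x j zero) (Φy-d j)) (+-identityʳ _))
  φ-dual gz (gx j′) = Φd-x j′
  φ-dual gz (gy j′) = Φd-y j′
  φ-dual gz gz      = trans (on-gz Φd) (trans (+-cong (Φd-x zero) Φd-d) (+-identityˡ _))

  δᴳ-diag : ∀ g → δᴳ g g ≡ 1#
  δᴳ-diag (gx j) = δ-diag j
  δᴳ-diag (gy j) = δ-diag j
  δᴳ-diag gz     = ≡.refl

  δᴳ-off : ∀ {g g′} → g ≢ g′ → δᴳ g g′ ≡ 0#
  δᴳ-off {gx j} {gx j′} g≢g′ = δ-off (λ j≡j′ → g≢g′ (≡.cong gx j≡j′))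
  δᴳ-off {gx j} {gy j′} _    = ≡.refl
  δᴳ-off {gx j} {gz}    _    = ≡.refl
  δᴳ-off {gy j} {gx j′} _    = ≡.refl
  δᴳ-off {gy j} {gy j′} g≢g′ = δ-off (λ j≡j′ → g≢g′ (≡.cong gy j≡j′))
  δᴳ-off {gy j} {gz}    _    = ≡.refl
  δᴳ-off {gz}   {gx j′} _    = ≡.refl
  δᴳ-off {gz}   {gy j′} _    = ≡.refl
  δᴳ-off {gz}   {gz}    g≢g′ = contradiction ≡.refl g≢g′

  φ-lincomb : ∀ {m} g (γ : Fin m → Carrier) (gen : Fin m → Generator) →
              ⟦ φ g ⟧ (lincomb γ (vec ∘ gen)) ≈ ∑[ t < m ] (γ t * δᴳ g (gen t))
  φ-lincomb g γ gen = trans (⟦⟧-lincomb (φ g) γ (vec ∘ gen)) (sum-cong-≋ (λ t → *-congˡ (φ-dual g (gen t))))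

  φ-coefficient : ∀ {m} (γ : Fin m → Carrier) {gen : Fin m → Generator} → Injective _≡_ _≡_ gen →
                  ∀ t₀ → ⟦ φ (gen t₀) ⟧ (lincomb γ (vec ∘ gen)) ≈ γ t₀
  φ-coefficient γ {gen} gen-inj t₀ =
    trans (φ-lincomb (gen t₀) γ gen) (trans (sum-cong-≋ (λ t → *-congˡ (reflexive (δᴳ≡δ t)))) (∑-δˡ γ t₀))
    where
    δᴳ≡δ : ∀ t → δᴳ (gen t₀) (gen t) ≡ δ t t₀
    δᴳ≡δ t with t Fin.≟ t₀
    ... | yes ≡.refl = ≡.trans (δᴳ-diag (gen t)) (≡.sym (δ-diag t))
    ... | no  t≢t₀   = ≡.trans (δᴳ-off (λ e → t≢t₀ (gen-inj (≡.sym e)))) (≡.sym (δ-off t≢t₀))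

  φ-avoid : ∀ {m} (γ : Fin m → Carrier) (gen : Fin m → Generator) {g} → (∀ t → g ≢ gen t) →
            ⟦ φ g ⟧ (lincomb γ (vec ∘ gen)) ≈ 0#
  φ-avoid γ gen {g} g∉gen = trans (φ-lincomb g γ gen)
    (∑-≈0 (λ t → trans (*-congˡ (reflexive (δᴳ-off (g∉gen t)))) (zeroʳ (γ t))))

  generators-independent : ∀ {m} {gen : Fin m → Generator} → Injective _≡_ _≡_ gen → LinIndep (vec ∘ gen)
  generators-independent {gen = gen} gen-inj γ γ·gen≈0 t =
    trans (sym (φ-coefficient γ gen-inj t)) (trans (⟦⟧-cong (φ (gen t)) γ·gen≈0) (⟦⟧-zeroᵛ (φ (gen t))))

  -- Subspaces spanned by k generators, one at each position

  position : Generator → Fin k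
  position (gx j) = j
  position (gy j) = j
  position gz     = zero

  record Frame : Set where
    field
      gen          : Fin k → Generator
      gen-position : ∀ p → position (gen p) ≡ p

    gen-injective : Injective _≡_ _≡_ gen
    gen-injective {p} {p′} gen≡ =
      ≡.trans (≡.sym (gen-position p)) (≡.trans (≡.cong position gen≡) (gen-position p′))

  open Frame

  ⟨_⟩ : Frame → Subspace k
  ⟨ A ⟩ = subspace (vec ∘ gen A) (generators-independent (gen-injective A))

  adjacent : ∀ (A B : Frame) p → (∀ t → t ≢ p → gen A t ≡ gen B t) → gen A p ≢ gen B p →
             Adjacent ⟨ A ⟩ ⟨ B ⟩
  adjacent A B p agree differ = w , w-indep , (λ t → w∈A t , w∈B t) , w-spans
    where
    w : Fin k′ → Vector
    w t = vec (gen A (punchIn p t))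
    w-indep : LinIndep w
    w-indep = generators-independent (λ e → Fin.punchIn-injective p _ _ (gen-injective A e))
    w∈A : ∀ t → w t ∈ ⟨ A ⟩
    w∈A t = InSpan-generator (vec ∘ gen A) (punchIn p t)
    w∈B : ∀ t → w t ∈ ⟨ B ⟩
    w∈B t rewrite agree (punchIn p t) (Fin.punchInᵢ≢i p t) = InSpan-generator (vec ∘ gen B) (punchIn p t)
    absent : ∀ t → gen A p ≢ gen B t
    absent t genAp≡genBt with t Fin.≟ p
    ... | yes ≡.refl = differ genAp≡genBt
    ... | no  t≢p    = t≢p (≡.trans (≡.sym (gen-position B t))
                             (≡.trans (≡.cong position (≡.sym genAp≡genBt)) (gen-position A p)))
    w-spans : ∀ x → x ∈ ⟨ A ⟩ → x ∈ ⟨ B ⟩ → InSpan w x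
    w-spans x (a , a·A≈x) (b , b·B≈x) = (λ t → a (punchIn p t)) , λ i → begin
      lincomb (λ t → a (punchIn p t)) w i                          ≈⟨ +-identityˡ _ ⟨
      0# + lincomb (λ t → a (punchIn p t)) w i                     ≈⟨ +-congʳ (trans (*-congʳ aₚ≈0) (zeroˡ _)) ⟨
      a p * vec (gen A p) i + lincomb (λ t → a (punchIn p t)) w i  ≈⟨ lincomb-remove p a (vec ∘ gen A) i ⟨
      lincomb a (vec ∘ gen A) i                                    ≈⟨ a·A≈x i ⟩
      x i                                                          ∎
      where
      aₚ≈0 : a p ≈ 0#
      aₚ≈0 = begin
        a p                                        ≈⟨ φ-coefficient a (gen-injective A) p ⟨
        ⟦ φ (gen A p) ⟧ (lincomb a (vec ∘ gen A))
          ≈⟨ ⟦⟧-cong (φ (gen A p)) (λ i → trans (a·A≈x i) (sym (b·B≈x i))) ⟩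
        ⟦ φ (gen A p) ⟧ (lincomb b (vec ∘ gen B))  ≈⟨ φ-avoid b (gen B) absent ⟩
        0#                                         ∎

  disjoint : ∀ (A B : Frame) → (∀ s t → gen A s ≢ gen B t) → ∀ x → x ∈ ⟨ A ⟩ → x ∈ ⟨ B ⟩ → x ≈ᵛ zeroᵛ
  disjoint A B A∌B x (a , a·A≈x) (b , b·B≈x) i =
    trans (sym (b·B≈x i)) (lincomb-zero (vec ∘ gen B) b≈0 i)
    where
    b≈0 : ∀ t → b t ≈ 0#
    b≈0 t = begin
      b t                                        ≈⟨ φ-coefficient b (gen-injective B) t ⟨
      ⟦ φ (gen B t) ⟧ (lincomb b (vec ∘ gen B))
        ≈⟨ ⟦⟧-cong (φ (gen B t)) (λ i → trans (b·B≈x i) (sym (a·A≈x i))) ⟩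
      ⟦ φ (gen B t) ⟧ (lincomb a (vec ∘ gen A))  ≈⟨ φ-avoid a (gen A) (λ s e → A∌B s t (≡.sym e)) ⟩
      0#                                         ∎

  nondegenerate : ∀ (A : Frame) → (∀ π s → Σ (Fin k) λ p → ¬ value (gen A p) π s ≈ 0#) → NonDegenerate ⟨ A ⟩
  nondegenerate A covers i ⟨A⟩≈0 with covers (pointAt i) (slopeAt i)
  ... | p , value≉0 = value≉0 (⟨A⟩≈0 (vec (gen A p)) (InSpan-generator (vec ∘ gen A) p))

  -- Non-degeneracy and the walk of length k + 1

  ≈1⇒≉0 : ∀ {x} → x ≈ 1# → ¬ x ≈ 0#
  ≈1⇒≉0 x≈1 x≈0 = 1≉0 (trans (sym x≈1) x≈0)

  gx-lead : ∀ π s → ¬ value (gx (lead π)) π s ≈ 0#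
  gx-lead π s = ≈1⇒≉0 (reflexive (coord-lead π))

  gz-lead-zero : ∀ {π} s → lead π ≡ zero → ¬ value gz π s ≈ 0#
  gz-lead-zero {π} s lead≡0 = ≈1⇒≉0 (begin
    coord π zero + marker (lead π) s  ≡⟨ ≡.cong₂ _+_ (≡.subst (λ f → coord π f ≡ 1#) lead≡0 (coord-lead π))
                                                     (marker-≢β s (λ lead≡β → 0≢β (≡.trans (≡.sym lead≡0) lead≡β))) ⟩
    1# + 0#                           ≈⟨ +-identityʳ 1# ⟩
    1#                                ∎)

  gz-β-zero-slope : ∀ {π σ} → lead π ≡ β → enum σ ≈ 0# → ¬ value gz π (inj₁ σ) ≈ 0#
  gz-β-zero-slope {π} {σ} lead≡β σ≈0 = ≈1⇒≉0 (begin
    coord π zero + marker (lead π) (inj₁ σ)  ≡⟨ ≡.cong₂ _+_ (coord-zero π (λ lead≡0 → 0≢β (≡.trans (≡.sym lead≡0) lead≡β)))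
                                                            (marker-zero-slope lead≡β σ≈0) ⟩
    0# + 1#                                  ≈⟨ +-identityˡ 1# ⟩
    1#                                       ∎)

  gy-base : ∀ π σ → ¬ value (gy (base (lead π))) π (inj₁ σ) ≈ 0#
  gy-base π σ = ≈1⇒≉0 (begin
    δ b b + enum σ * δ β b  ≡⟨ ≡.cong₂ (λ u v → u + enum σ * v) (δ-diag b)
                                 (δ-off (λ β≡b → base≢β (lead π) (≡.sym β≡b))) ⟩
    1# + enum σ * 0#        ≈⟨ trans (+-congˡ (zeroʳ _)) (+-identityʳ 1#) ⟩
    1#                      ∎)
    where
    b : Fin k
    b = base (lead π)

  gy-β-∞ : ∀ π u → ¬ value (gy β) π (inj₂ u) ≈ 0#
  gy-β-∞ π u = ≈1⇒≉0 (reflexive (δ-diag β))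

  gy-β-slope : ∀ π {σ} → ¬ enum σ ≈ 0# → ¬ value (gy β) π (inj₁ σ) ≈ 0#
  gy-β-slope π {σ} σ≉0 value≈0 = σ≉0 (begin
    enum σ                                ≈⟨ trans (sym (*-identityʳ _)) (sym (+-identityˡ _)) ⟩
    0# + enum σ * 1#                      ≡⟨ ≡.cong₂ (λ u v → u + enum σ * v)
                                               (≡.sym (δ-off (base≢β (lead π)))) (≡.sym (δ-diag β)) ⟩
    δ (base (lead π)) β + enum σ * δ β β  ≈⟨ value≈0 ⟩
    0#                                    ∎)

  xFrame yFrame : Frame
  xFrame = record { gen = gx ; gen-position = λ _ → ≡.refl }
  yFrame = record { gen = gy ; gen-position = λ _ → ≡.refl }

  choose : ∀ {P : Set} → Dec P → Fin k → Generator
  choose (yes _) = gy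
  choose (no  _) = gx

  choose-position : ∀ {P : Set} (P? : Dec P) p → position (choose P? p) ≡ p
  choose-position (yes _) p = ≡.refl
  choose-position (no  _) p = ≡.refl

  -- Position 0 holds x_0 + d; position suc j holds y iff m ≤ j, so y_β is present as soon as any y_j is.
  middleFrame : ℕ → Frame
  middleFrame m = record { gen = gen′ ; gen-position = gen′-position }
    where
    gen′ : Fin k → Generator
    gen′ zero    = gz
    gen′ (suc j) = choose (m ℕ.≤? toℕ j) (suc j)
    gen′-position : ∀ p → position (gen′ p) ≡ p
    gen′-position zero    = ≡.refl
    gen′-position (suc j) = choose-position (m ℕ.≤? toℕ j) (suc j)

  middleFrame-y : ∀ {m j} → m ≤ toℕ j → gen (middleFrame m) (suc j) ≡ gy (suc j)
  middleFrame-y {m} {j} m≤j with m ℕ.≤? toℕ j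
  ... | yes _   = ≡.refl
  ... | no  m≰j = contradiction m≤j m≰j

  middleFrame-x : ∀ {m j} → ¬ m ≤ toℕ j → gen (middleFrame m) (suc j) ≡ gx (suc j)
  middleFrame-x {m} {j} m≰j with m ℕ.≤? toℕ j
  ... | yes m≤j = contradiction m≤j m≰j
  ... | no  _   = ≡.refl

  xFrame-covers : ∀ π s → Σ (Fin k) λ p → ¬ value (gen xFrame p) π s ≈ 0#
  xFrame-covers π s = lead π , gx-lead π s

  yFrame-covers : ∀ π s → Σ (Fin k) λ p → ¬ value (gen yFrame p) π s ≈ 0#
  yFrame-covers π (inj₁ σ) = base (lead π) , gy-base π σ
  yFrame-covers π (inj₂ u) = β , gy-β-∞ π u

  middleFrame-covers : ∀ m π s → Σ (Fin k) λ p → ¬ value (gen (middleFrame m) p) π s ≈ 0#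
  middleFrame-covers m π s with lead π in lead≡
  ... | zero  = zero , gz-lead-zero s lead≡
  ... | suc f with m ℕ.≤? toℕ f
  ...   | no m≰f  = suc f , ≡.subst (λ g → ¬ value g π s ≈ 0#) (≡.sym (middleFrame-x m≰f))
                              (≡.subst (λ j → ¬ value (gx j) π s ≈ 0#) lead≡ (gx-lead π s))
  ...   | yes m≤f = later s
    where
    β-is-y : gen (middleFrame m) β ≡ gy β
    β-is-y = middleFrame-y (ℕ.≤-trans m≤f
               (ℕ.≤-trans (Fin.toℕ≤pred[n] f) (ℕ.≤-reflexive (≡.sym (Fin.toℕ-fromℕ k₀)))))
    via-β : ∀ {s} → ¬ value (gy β) π s ≈ 0# → Σ (Fin k) λ p → ¬ value (gen (middleFrame m) p) π s ≈ 0#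
    via-β {s} v≉0 = β , ≡.subst (λ g → ¬ value g π s ≈ 0#) (≡.sym β-is-y) v≉0
    later : ∀ s → Σ (Fin k) λ p → ¬ value (gen (middleFrame m) p) π s ≈ 0#
    later (inj₂ u) = via-β (gy-β-∞ π u)
    later (inj₁ σ) with suc f Fin.≟ β | enum σ ≟ 0#
    ... | yes f≡β | yes σ≈0 = zero , gz-β-zero-slope (≡.trans lead≡ f≡β) σ≈0
    ... | yes _   | no  σ≉0 = via-β (gy-β-slope π σ≉0)
    ... | no  f≢β | _       = suc f , ≡.subst (λ g → ¬ value g π (inj₁ σ) ≈ 0#) (≡.sym (middleFrame-y m≤f))
                                  (≡.subst (λ j → ¬ value (gy j) π (inj₁ σ) ≈ 0#) base-lead (gy-base π σ))
      where
      base-lead : base (lead π) ≡ suc f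
      base-lead = ≡.trans (≡.cong base lead≡) (base-≢β f≢β)

  X Y : Subspace k
  X = ⟨ xFrame ⟩
  Y = ⟨ yFrame ⟩

  xFrame~middleFrame : Adjacent X ⟨ middleFrame k′ ⟩
  xFrame~middleFrame = adjacent xFrame (middleFrame k′) zero agree (λ ())
    where
    agree : ∀ t → t ≢ zero → gx t ≡ gen (middleFrame k′) t
    agree zero    0≢0 = contradiction ≡.refl 0≢0
    agree (suc j) _   = ≡.sym (middleFrame-x (ℕ.<⇒≱ (Fin.toℕ<n j)))

  middleFrame~middleFrame : ∀ {m} → m < k′ → Adjacent ⟨ middleFrame (suc m) ⟩ ⟨ middleFrame m ⟩
  middleFrame~middleFrame {m} m<k′ = adjacent (middleFrame (suc m)) (middleFrame m) (suc j₀) agree differ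
    where
    j₀ : Fin k′
    j₀ = Fin.fromℕ< m<k′
    agree : ∀ t → t ≢ suc j₀ → gen (middleFrame (suc m)) t ≡ gen (middleFrame m) t
    agree zero    _     = ≡.refl
    agree (suc j) j≢j₀ = by-cases (m ℕ.≤? toℕ j)
      where
      m≢j : m ≢ toℕ j
      m≢j m≡j = j≢j₀ (≡.cong suc (Fin.toℕ-injective (≡.trans (≡.sym m≡j) (≡.sym (Fin.toℕ-fromℕ< m<k′)))))
      by-cases : Dec (m ≤ toℕ j) → gen (middleFrame (suc m)) (suc j) ≡ gen (middleFrame m) (suc j)
      by-cases (no  m≰j) = ≡.trans (middleFrame-x (λ m<j → m≰j (ℕ.<⇒≤ m<j))) (≡.sym (middleFrame-x m≰j))
      by-cases (yes m≤j) = ≡.trans (middleFrame-y (ℕ.≤∧≢⇒< m≤j m≢j)) (≡.sym (middleFrame-y m≤j))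
    differ : gen (middleFrame (suc m)) (suc j₀) ≢ gen (middleFrame m) (suc j₀)
    differ x≡y = gx≢gy (≡.trans (≡.sym (middleFrame-x j₀≱sm)) (≡.trans x≡y (middleFrame-y m≤j₀)))
      where
      m≤j₀ : m ≤ toℕ j₀
      m≤j₀ = ℕ.≤-reflexive (≡.sym (Fin.toℕ-fromℕ< m<k′))
      j₀≱sm : ¬ suc m ≤ toℕ j₀
      j₀≱sm = ℕ.<⇒≱ (ℕ.≤-reflexive (≡.cong suc (Fin.toℕ-fromℕ< m<k′)))
      gx≢gy : gx (suc j₀) ≢ gy (suc j₀)
      gx≢gy ()

  middleFrame~yFrame : Adjacent ⟨ middleFrame 0 ⟩ Y
  middleFrame~yFrame = adjacent (middleFrame 0) yFrame zero agree (λ ())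
    where
    agree : ∀ t → t ≢ zero → gen (middleFrame 0) t ≡ gy t
    agree zero    0≢0 = contradiction ≡.refl 0≢0
    agree (suc j) _   = middleFrame-y z≤n

  SameSubspace-refl : ∀ (V : Subspace k) → SameSubspace V V
  SameSubspace-refl V _ = id , id

  walk-from-middle : ∀ m → m ≤ k′ → Walk ⟨ middleFrame m ⟩ Y (suc m)
  walk-from-middle zero    _     =
    step Y (nondegenerate yFrame yFrame-covers) middleFrame~yFrame (here (SameSubspace-refl Y))
  walk-from-middle (suc m) m<k′ =
    step ⟨ middleFrame m ⟩ (nondegenerate (middleFrame m) (middleFrame-covers m)) (middleFrame~middleFrame m<k′)
         (walk-from-middle m (ℕ.<⇒≤ m<k′))

  walk : Walk X Y (suc k)
  walk = step ⟨ middleFrame k′ ⟩ (nondegenerate (middleFrame k′) (middleFrame-covers k′)) xFrame~middleFrame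
              (walk-from-middle k′ ℕ.≤-refl)

  -- No shorter walk

  X∩Y≈0 : ∀ x → x ∈ X → x ∈ Y → x ≈ᵛ zeroᵛ
  X∩Y≈0 = disjoint xFrame yFrame (λ _ _ ())

  X∩Y-trivial : IntersectionHasDim X Y 0
  X∩Y-trivial = (λ ()) , (λ _ _ ()) , (λ ()) , λ x x∈X x∈Y → (λ ()) , λ i → sym (X∩Y≈0 x x∈X x∈Y i)

  hyperplane-vanishes-on-point : (w : Fin k′ → Vector) → (∀ t → w t ∈ X) →
                                 Σ (Point k) λ π → ∀ t s → w t (column π s) ≈ 0#
  hyperplane-vanishes-on-point w w∈X
    with homogeneous-solutions 1 (ℕ.≤-reflexive (ℕ.+-comm k′ 1)) (λ t → proj₁ (w∈X t))
  ... | K , K-solves , K-indep with normalise (K zero) (Independent-nonzero K K-indep)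
  ...   | π , μ , _ , coord≈μp = π , w≈0
    where
    A : Fin k′ → Fin k → Carrier
    A t = proj₁ (w∈X t)
    w≈0 : ∀ t s → w t (column π s) ≈ 0#
    w≈0 t s = begin
      w t (column π s)                               ≈⟨ proj₂ (w∈X t) (column π s) ⟨
      lincomb (A t) (vec ∘ gx) (column π s)          ≡⟨ lincomb-coord (A t) (vec ∘ gx) (column π s) ⟩
      ∑[ j < k ] (A t j * vec (gx j) (column π s))   ≡⟨ sum-cong-≗ (λ j → ≡.cong (A t j *_)
                                                           (columnVector-column (value (gx j)) π s)) ⟩
      ∑[ j < k ] (A t j * coord π j)                 ≈⟨ sum-cong-≋ (λ j → *-congˡ {A t j} (coord≈μp j)) ⟩
      ∑[ j < k ] (A t j * (μ * K zero j))            ≈⟨ sum-cong-≋ (λ j → x∙yz≈y∙xz (A t j) μ (K zero j)) ⟩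
      ∑[ j < k ] (μ * (A t j * K zero j))            ≈⟨ *-distribˡ-sum μ (λ j → A t j * K zero j) ⟨
      μ * ∑[ j < k ] (A t j * K zero j)              ≈⟨ *-congˡ (K-solves zero t) ⟩
      μ * 0#                                         ≈⟨ zeroʳ μ ⟩
      0#                                             ∎

  Y-at-column : ∀ {u} ((c , _) : u ∈ Y) π s → u (column π s) ≈ ∑[ j < k ] (c j * line (base (lead π)) s j)
  Y-at-column {u} (c , c·Y≈u) π s = begin
    u (column π s)                                 ≈⟨ c·Y≈u (column π s) ⟨
    lincomb c (vec ∘ gy) (column π s)              ≡⟨ lincomb-coord c (vec ∘ gy) (column π s) ⟩
    ∑[ j < k ] (c j * vec (gy j) (column π s))     ≡⟨ sum-cong-≗ (λ j → ≡.cong (c j *_)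
                                                         (columnVector-column (value (gy j)) π s)) ⟩
    ∑[ j < k ] (c j * line (base (lead π)) s j)    ∎

  ∑-line : ∀ (c : Fin k → Carrier) a σ → ∑[ j < k ] (c j * line a (inj₁ σ) j) ≈ c a + enum σ * c β
  ∑-line c a σ = begin
    ∑[ j < k ] (c j * (δ a j + enum σ * δ β j))
      ≈⟨ sum-cong-≋ (λ j → distribˡ (c j) (δ a j) (enum σ * δ β j)) ⟩
    ∑[ j < k ] (c j * δ a j + c j * (enum σ * δ β j))
      ≈⟨ ∑-distrib-+ (λ j → c j * δ a j) (λ j → c j * (enum σ * δ β j)) ⟩
    ∑[ j < k ] (c j * δ a j) + ∑[ j < k ] (c j * (enum σ * δ β j))
      ≈⟨ +-cong (∑-δʳ c a) (sum-cong-≋ (λ j → x∙yz≈y∙xz (c j) (enum σ) (δ β j))) ⟩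
    c a + ∑[ j < k ] (enum σ * (c j * δ β j))           ≈⟨ +-congˡ (*-distribˡ-sum (enum σ) (λ j → c j * δ β j)) ⟨
    c a + enum σ * ∑[ j < k ] (c j * δ β j)             ≈⟨ +-congˡ (*-congˡ (∑-δʳ c β)) ⟩
    c a + enum σ * c β                                  ∎

  Y-vanishes-on-line : ∀ {u} → u ∈ Y → ∀ π → Σ Slope λ s → u (column π s) ≈ 0#
  Y-vanishes-on-line {u} u∈Y@(c , _) π with c β ≟ 0#
  ... | yes cβ≈0 = ∞ , trans (Y-at-column u∈Y π ∞) (trans (∑-δʳ c β) cβ≈0)
  ... | no  cβ≉0 = inj₁ σ , trans (Y-at-column u∈Y π (inj₁ σ)) (trans (∑-line c a σ) (begin
    c a + enum σ * c β                ≈⟨ +-congˡ (*-congʳ (proj₂ (name _))) ⟩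
    c a + - (c a * cβ⁻¹) * c β        ≈⟨ +-congˡ (-‿distribˡ-* _ _) ⟨
    c a + - (c a * cβ⁻¹ * c β)        ≈⟨ +-congˡ (-‿cong (*-assoc _ _ _)) ⟩
    c a + - (c a * (cβ⁻¹ * c β))      ≈⟨ +-congˡ (-‿cong (*-congˡ (trans (*-comm _ _) (proj₂ (inverse (c β) cβ≉0))))) ⟩
    c a + - (c a * 1#)                ≈⟨ x≈y⇒x∙y⁻¹≈ε (sym (*-identityʳ _)) ⟩
    0#                                ∎))
    where
    a : Fin k
    a = base (lead π)
    cβ⁻¹ : Carrier
    cβ⁻¹ = proj₁ (inverse (c β) cβ≉0)
    σ : Fin q
    σ = proj₁ (name (- (c a * cβ⁻¹)))

  -- The first vertex Z₁ after X contains the hyperplane w of X and a vector u of Y; on the column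
  -- (π, s) where both vanish, every vector of Z₁ = span (u ∷ w) vanishes.
  no-walk-of-length-k : Walk X Y k → ⊥
  no-walk-of-length-k (step Z₁ Z₁-nondeg (w , w-indep , w∈X∩Z₁ , _) Z₁⇝Y) =
    Z₁-nondeg (column π s) Z₁-vanishes
    where
    shared : Dim∩≥ Z₁ Y 1
    shared = ≡.subst (Dim∩≥ Z₁ Y) (ℕ.m+n∸n≡m 1 k′) (Dim∩≥-walk Z₁⇝Y)
    u : Vector
    u = proj₁ shared zero
    u∈Y : u ∈ Y
    u∈Y = proj₂ (proj₂ (proj₂ shared) zero)
    w∈X : ∀ t → w t ∈ X
    w∈X t = proj₁ (w∈X∩Z₁ t)
    π : Point k
    π = proj₁ (hyperplane-vanishes-on-point w w∈X)
    s : Slope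
    s = proj₁ (Y-vanishes-on-line u∈Y π)
    u∷w∈Z₁ : ∀ t → (u ∷ w) t ∈ Z₁
    u∷w∈Z₁ zero    = proj₁ (proj₂ (proj₂ shared) zero)
    u∷w∈Z₁ (suc t) = proj₂ (w∈X∩Z₁ t)
    u∷w-vanish : ∀ t → (u ∷ w) t (column π s) ≈ 0#
    u∷w-vanish zero    = proj₂ (Y-vanishes-on-line u∈Y π)
    u∷w-vanish (suc t) = proj₂ (hyperplane-vanishes-on-point w w∈X) t s
    u∷w-indep : LinIndep (u ∷ w)
    u∷w-indep = LinIndep-∷ {u = u} {w} w-indep λ γ₀ γ γ₀u+γw≈0 →
      scale-nonzero (LinIndep-head-nonzero {u = proj₁ shared} (proj₁ (proj₂ shared)))
        (X∩Y≈0 (γ₀ ·ᵛ u)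
          (InSpan-resp-≈ᵛ {v = vec ∘ gx} (InSpan-lincomb (λ t → - γ t) {w} {vec ∘ gx} w∈X)
            (λ i → trans (lincomb-neg γ w i) (sym (+-inverseˡ-unique _ _ (γ₀u+γw≈0 i)))))
          (InSpan-scale {v = vec ∘ gy} γ₀ u∈Y))
    Z₁-vanishes : ∀ x → x ∈ Z₁ → x (column π s) ≈ 0#
    Z₁-vanishes x x∈Z₁ =
      InSpan-vanishes {v = u ∷ w} (column π s) u∷w-vanish (independent-spans Z₁ {u ∷ w} u∷w-indep u∷w∈Z₁ x∈Z₁)

  no-short-walk : ∀ {m} → m < k → Walk X Y m → ⊥
  no-short-walk {m} m<k X⇝Y =
    LinIndep-head-nonzero {u = proj₁ shared} (proj₁ (proj₂ shared))
      (X∩Y≈0 _ (proj₁ (proj₂ (proj₂ shared) zero)) (proj₂ (proj₂ (proj₂ shared) zero)))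
    where
    shared : Dim∩≥ X Y (suc (k′ ∸ m))
    shared = ≡.subst (Dim∩≥ X Y) (ℕ.+-∸-assoc 1 (ℕ.≤-pred m<k)) (Dim∩≥-walk X⇝Y)

  walks-are-long : ∀ m → Walk X Y m → suc k ≤ m
  walks-are-long m X⇝Y with m ℕ.≤? k
  ... | no  m≰k = ℕ.≰⇒> m≰k
  ... | yes m≤k with ℕ.m≤n⇒m<n∨m≡n m≤k
  ...   | inj₁ m<k    = ⊥-elim (no-short-walk m<k X⇝Y)
  ...   | inj₂ ≡.refl = ⊥-elim (no-walk-of-length-k X⇝Y)

open import Data.Nat using (_+_; _*_)

lemma5 : ∀ {c ℓ : Level} (F : Field c ℓ) (q n k : ℕ) →
    IsPrimePower q → HasCardinality F q →
    2 ≤ k → k + k ≤ n → n ≡ ([ k ] q) * (q + 1) →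
    let open LinearAlgebra F n in
    Σ (Subspace k) λ X → Σ (Subspace k) λ Y →
      NonDegenerate X × NonDegenerate Y ×
      GrassmannDist X Y k × CodeDist X Y (suc k)
lemma5 F q _ (suc (suc k₀)) _ card (s≤s (s≤s z≤n)) _ ≡.refl =
  X , Y , nondegenerate xFrame xFrame-covers , nondegenerate yFrame yFrame-covers ,
  (0 , X∩Y-trivial , ≡.refl) , (walk , walks-are-long)
  where open Construction F q card k₀
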